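{- Let $n\ge1$. Then $\varphi(I_n^{0,1})=\varphi(I_n^0)=\mathring{\mathfrak P}_n$.
   Context: Notation: $[m]=\{1,\dots,m\}$. Type B: $\mathcal B_n$ is the group of signed permutations (bijections $w$ of $\{\pm1,\dots,\pm n\}$ with $w(-i)=-w(i)$), written $w=w_1\cdots w_n$, negative entries $-k$ written $\bar k$; entries ordered $\cdots<\bar2<\bar1<1<2<\cdots$. $\mathrm{Des}(w)=\{i\in\{0,\dots,n-1\}: w_i>w_{i+1}\}$ with $w_0=0$. For $J\subseteq\{0,\dots,n-1\}$, $Y_J=\sum_{\mathrm{Des}(w)=J}w\in\mathbb Q\mathcal B_n$ and $X_J=\sum_{I\subseteq J}Y_I$. Define $I_n^0=\mathrm{Span}\{X_{\{0\}\cup J}: J\subseteq[n-1]\}$ and $I_n^{0,1}=\mathrm{Span}\{X_J: J\subseteq\{0,\dots,n-1\},\ 0\in J\text{ or }1\in J\}$. $\varphi:\mathbb Q\mathcal B_n\to\mathbb Q\mathcal S_n$ is the linear map forgetting signs, $w\mapsto|w_1|\cdots|w_n|$. Type A: for $w\in\mathcal S_n$, $\mathring{\mathrm{Peak}}(w)=\{i\in\{2,\dots,n-1\}: w_{i-1}<w_i>w_{i+1}\}$. $\mathring{\mathcal F}_n$ is the set of subsets of $\{2,\dots,n-1\}$ containing no two consecutive integers. For $F\in\mathring{\mathcal F}_n$, $\mathring P_F=\sum_{\mathring{\mathrm{Peak}}(w)=F}w$, and $\mathring{\mathfrak P}_n$ is the span of these elements. -}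

module Defs where

open import Data.Nat as ℕ using (ℕ; zero; suc; _∸_)
open import Data.Integer as ℤ using (ℤ; +_; ∣_∣)
open import Data.Rational as ℚ using (ℚ; 0ℚ; 1ℚ)
open import Data.List using (List; []; _∷_; map; _++_; concatMap; filter; foldr; upTo)
open import Data.List.Membership.Propositional using (_∈_)
open import Data.Bool using (Bool; true; false; if_then_else_; _∧_; _∨_; not)
open import Data.Product using (Σ; _×_)
open import Relation.Nullary.Decidable using (⌊_⌋)
open import Relation.Binary.PropositionalEquality using (_≡_)

-- all sublists (order preserved); on an ascending list these are exactly
-- its subsets, each written as an ascending list
sublists : List ℕ → List (List ℕ)
sublists [] = [] ∷ []
sublists (x ∷ xs) = map (x ∷_) (sublists xs) ++ sublists xs

eqListℕ : List ℕ → List ℕ → Bool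
eqListℕ [] [] = true
eqListℕ (x ∷ xs) (y ∷ ys) = (x ℕ.≡ᵇ y) ∧ eqListℕ xs ys
eqListℕ _ _ = false

memℕ : ℕ → List ℕ → Bool
memℕ x [] = false
memℕ x (y ∷ ys) = (x ℕ.≡ᵇ y) ∨ memℕ x ys

sumℚ : List ℚ → ℚ
sumℚ = foldr ℚ._+_ 0ℚ

range : ℕ → ℕ → List ℕ
range a k = map (a ℕ.+_) (upTo k)

-- Groups: S_n as one-line notations (lists of 1..n), B_n as lists of ℤ

insertAll : ℕ → List ℕ → List (List ℕ)
insertAll x [] = (x ∷ []) ∷ []
insertAll x (y ∷ ys) = (x ∷ y ∷ ys) ∷ map (y ∷_) (insertAll x ys)

perms : List ℕ → List (List ℕ)
perms [] = [] ∷ []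
perms (x ∷ xs) = concatMap (insertAll x) (perms xs)

Sn : ℕ → List (List ℕ)
Sn n = perms (range 1 n)

signings : List ℕ → List (List ℤ)
signings [] = [] ∷ []
signings (k ∷ ks) = concatMap (λ s → (+ k ∷ s) ∷ (ℤ.- (+ k) ∷ s) ∷ []) (signings ks)

-- all elements of B_n (each exactly once); negative entry -k is ̄k
Bn : ℕ → List (List ℤ)
Bn n = concatMap signings (Sn n)

-- Group algebras: an element of ℚ𝓑_n is its coefficient function
-- (only the values on B_n matter); likewise for ℚ𝓢_n.

QB : Set
QB = List ℤ → ℚ

QS : Set
QS = List ℕ → ℚ

desGo : ℕ → ℤ → List ℤ → List ℕ
desGo i prev [] = []
desGo i prev (a ∷ as) =
  if ⌊ a ℤ.<? prev ⌋ then i ∷ desGo (suc i) a as else desGo (suc i) a as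

Des : List ℤ → List ℕ
Des w = desGo 0 (+ 0) w

Y : List ℕ → QB
Y J w = if eqListℕ (Des w) J then 1ℚ else 0ℚ

-- X_J = Σ_{I ⊆ J} Y_I   (J given as an ascending list)
X : List ℕ → QB
X J w = sumℚ (map (λ I → Y I w) (sublists J))

gensI0 : ℕ → List (List ℕ)
gensI0 n = map (0 ∷_) (sublists (range 1 (n ∸ 1)))

gensI01 : ℕ → List (List ℕ)
gensI01 n = filter (λ J → Data.Bool.T? (memℕ 0 J ∨ memℕ 1 J)) (sublists (range 0 n))
  where import Data.Bool

-- positions i ∈ {2..n-1} with w_{i-1} < w_i > w_{i+1}; `i` is the
-- (1-based) position of the first entry of the window
peakGo : ℕ → List ℕ → List ℕ
peakGo i (a ∷ b ∷ c ∷ rest) =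
  if (a ℕ.<ᵇ b) ∧ (c ℕ.<ᵇ b) then suc i ∷ peakGo (suc i) (b ∷ c ∷ rest)
  else peakGo (suc i) (b ∷ c ∷ rest)
peakGo i _ = []

Peak : List ℕ → List ℕ
Peak w = peakGo 1 w

noConsec : List ℕ → Bool
noConsec (a ∷ b ∷ rest) = not (suc a ℕ.≡ᵇ b) ∧ noConsec (b ∷ rest)
noConsec _ = true

Fn : ℕ → List (List ℕ)
Fn n = filter (λ F → Data.Bool.T? (noConsec F)) (sublists (range 2 (n ∸ 2)))
  where import Data.Bool

P : List ℕ → QS
P F σ = if eqListℕ (Peak σ) F then 1ℚ else 0ℚ

φ : ℕ → QB → QS
φ n x σ = sumℚ (map x (filter (λ w → Data.Bool.T? (eqListℕ (map ∣_∣ w) σ)) (Bn n)))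
  where import Data.Bool

-- y ∈ Span { g a : a ∈ gens }, equality tested on the group elements `G`
InSpan : {A K : Set} → List K → List A → (A → K → ℚ) → (K → ℚ) → Set
InSpan {A} G gens g y =
  Σ (A → ℚ) λ c → ∀ k → k ∈ G → y k ≡ sumℚ (map (λ a → c a ℚ.* g a k) gens)

I0 : ℕ → QB → Set
I0 n = InSpan (Bn n) (gensI0 n) X

I01 : ℕ → QB → Set
I01 n = InSpan (Bn n) (gensI01 n) X

PeakAlg : ℕ → QS → Set
PeakAlg n = InSpan (Sn n) (Fn n) P

InImageφ : ℕ → (QB → Set) → QS → Set
InImageφ n I y = Σ QB λ x → I x × (∀ σ → σ ∈ Sn n → y σ ≡ φ n x σ)

{-# OPTIONS --safe #-}
-- A signed permutation w contributes to X_J exactly when Des(w) ⊆ J, so φ(X_J)(σ) counts the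
-- signings of σ whose descents all lie in J.  Reading a signing letter by letter and tracking the
-- sign of the last letter, one finds that for 0 ∈ J or 1 ∈ J this count is 2^|J| if every
-- interior peak p of σ has p - 1 ∈ J or p ∈ J, and 0 otherwise (a peak with neither p - 1 nor p
-- in J forces a descent outside J).  Hence φ(I_n^{0,1}) lies in the peak algebra.  Conversely,
-- for J ⊆ [n-1] the functions Q ↦ [every p ∈ Q has p - 1 ∈ J or p ∈ J] span all functions of
-- the peak set Q: the indicator of Q = F is an explicit combination whose coefficients factor
-- over the gaps between consecutive elements of F.  So the peak algebra lies in
-- φ(I_n^0) ⊆ φ(I_n^{0,1}).

module Submission where

open import Defs
open import Data.Bool using (Bool; true; false; T; T?; if_then_else_; _∧_; _∨_; not)
import Data.Bool.Properties as Boolₚ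
open import Data.Empty using (⊥; ⊥-elim)
open import Data.Integer as ℤ using (ℤ; -[1+_]; ∣_∣)
import Data.Integer.Properties as ℤₚ
open import Data.List
  using (List; []; _∷_; _++_; map; concatMap; filter; upTo; applyUpTo; length; null; drop; takeWhile; dropWhile)
import Data.List.Properties as Listₚ
open import Data.List.Membership.Propositional using (_∈_; _∉_; find)
open import Data.List.Membership.Propositional.Properties using (∈-++⁻; ∈-map⁻; ∈-filter⁻; ∈-concatMap⁻)
open import Data.List.Relation.Unary.All as All using (All; []; _∷_)
import Data.List.Relation.Unary.All.Properties as Allₚ
open import Data.List.Relation.Unary.Any using (here; there)
open import Data.List.Relation.Unary.AllPairs using ([]; _∷_)
open import Data.List.Relation.Unary.Unique.Propositional using (Unique)
import Data.List.Relation.Unary.Unique.Propositional.Properties as Uniqueₚ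
open import Data.List.Relation.Binary.Permutation.Propositional
  using (_↭_; ↭-refl; ↭-prep; ↭-swap; ↭-trans; ↭-sym; ↭⇒↭ₛ)
open import Data.List.Relation.Binary.Permutation.Propositional.Properties using (∈-resp-↭; ↭-length)
import Data.List.Relation.Binary.Permutation.Setoid.Properties as Permutationₛ
open import Data.Nat as ℕ using (ℕ; zero; suc; _∸_; _≤_; _<_; z≤n; s≤s)
import Data.Nat.Properties as ℕₚ
open import Data.Product using (_×_; _,_; proj₁; proj₂)
open import Data.Rational using (ℚ; 0ℚ; 1ℚ; ½; _+_; _*_; -_)
import Data.Rational.Properties as ℚₚ
open import Data.Rational.Solver using (module +-*-Solver)
open import Data.Sum using (inj₁; inj₂)
open import Function using (_∘_)
open import Function.Bundles using (_⇔_; mk⇔; Equivalence)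
open import Relation.Binary.PropositionalEquality
open import Relation.Binary using (tri<; tri≈; tri>)
open import Relation.Nullary using (yes; no; contradiction; Reflects; ofʸ; ofⁿ)
open import Relation.Nullary.Decidable using (⌊_⌋; dec-true; dec-false; isYes≗does)

open +-*-Solver using (solve; _:=_; _:+_; _:*_; :-_; con)

∑ : {A : Set} → List A → (A → ℚ) → ℚ
∑ xs f = sumℚ (map f xs)

infix 5 ∑
syntax ∑ xs (λ x → e) = ∑[ x ∈ xs ] e

private variable A B : Set

∑-++ : (xs ys : List A) (f : A → ℚ) → ∑ (xs ++ ys) f ≡ ∑ xs f + ∑ ys f
∑-++ []       ys f = sym (ℚₚ.+-identityˡ _)
∑-++ (x ∷ xs) ys f = trans (cong (f x +_) (∑-++ xs ys f)) (sym (ℚₚ.+-assoc (f x) _ _))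

∑-cong : (xs : List A) {f g : A → ℚ} → (∀ {x} → x ∈ xs → f x ≡ g x) → ∑ xs f ≡ ∑ xs g
∑-cong []       _   = refl
∑-cong (x ∷ xs) f≗g = cong₂ _+_ (f≗g (here refl)) (∑-cong xs (f≗g ∘ there))

∑-zero : (xs : List A) {f : A → ℚ} → (∀ {x} → x ∈ xs → f x ≡ 0ℚ) → ∑ xs f ≡ 0ℚ
∑-zero []       _    = refl
∑-zero (x ∷ xs) f≗0 = cong₂ _+_ (f≗0 (here refl)) (∑-zero xs (f≗0 ∘ there))

∑-+ : (xs : List A) (f g : A → ℚ) → (∑[ x ∈ xs ] (f x + g x)) ≡ ∑ xs f + ∑ xs g
∑-+ []       f g = refl
∑-+ (x ∷ xs) f g = trans (cong (f x + g x +_) (∑-+ xs f g))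
  (solve 4 (λ a b c d → (a :+ b) :+ (c :+ d) := (a :+ c) :+ (b :+ d)) refl (f x) (g x) _ _)

∑-*ˡ : (xs : List A) (c : ℚ) (f : A → ℚ) → (∑[ x ∈ xs ] (c * f x)) ≡ c * ∑ xs f
∑-*ˡ []       c f = sym (ℚₚ.*-zeroʳ c)
∑-*ˡ (x ∷ xs) c f = trans (cong (c * f x +_) (∑-*ˡ xs c f)) (sym (ℚₚ.*-distribˡ-+ c (f x) _))

∑-*ʳ : (xs : List A) (c : ℚ) (f : A → ℚ) → (∑[ x ∈ xs ] (f x * c)) ≡ ∑ xs f * c
∑-*ʳ xs c f = trans (∑-cong xs (λ {x} _ → ℚₚ.*-comm (f x) c)) (trans (∑-*ˡ xs c f) (ℚₚ.*-comm c _))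

∑-map : (g : A → B) (xs : List A) (f : B → ℚ) → ∑ (map g xs) f ≡ ∑ xs (f ∘ g)
∑-map g []       f = refl
∑-map g (x ∷ xs) f = cong (f (g x) +_) (∑-map g xs f)

∑-concatMap : (g : A → List B) (xs : List A) (f : B → ℚ) →
              ∑ (concatMap g xs) f ≡ (∑[ x ∈ xs ] ∑ (g x) f)
∑-concatMap g []       f = refl
∑-concatMap g (x ∷ xs) f = trans (∑-++ (g x) _ f) (cong (∑ (g x) f +_) (∑-concatMap g xs f))

∑-comm : (xs : List A) (ys : List B) (h : A → B → ℚ) →
         (∑[ x ∈ xs ] ∑[ y ∈ ys ] h x y) ≡ (∑[ y ∈ ys ] ∑[ x ∈ xs ] h x y)
∑-comm []       ys h = sym (∑-zero ys (λ _ → refl))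
∑-comm (x ∷ xs) ys h =
  trans (cong (∑ ys (h x) +_) (∑-comm xs ys h)) (sym (∑-+ ys (h x) (λ y → ∑[ x ∈ xs ] h x y)))

⟦_⟧ : Bool → ℚ
⟦ b ⟧ = if b then 1ℚ else 0ℚ

⟦∧⟧ : ∀ x y → ⟦ x ∧ y ⟧ ≡ ⟦ x ⟧ * ⟦ y ⟧
⟦∧⟧ true  y = sym (ℚₚ.*-identityˡ ⟦ y ⟧)
⟦∧⟧ false y = sym (ℚₚ.*-zeroˡ ⟦ y ⟧)

∑-filter : (p : A → Bool) (xs : List A) (f : A → ℚ) →
           ∑ (filter (T? ∘ p) xs) f ≡ (∑[ x ∈ xs ] (⟦ p x ⟧ * f x))
∑-filter p []       f = refl
∑-filter p (x ∷ xs) f with p x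
... | true  = cong₂ _+_ (sym (ℚₚ.*-identityˡ (f x))) (∑-filter p xs f)
... | false = trans (∑-filter p xs f) (sym (trans (cong (_+ _) (ℚₚ.*-zeroˡ (f x))) (ℚₚ.+-identityˡ _)))

≡ᵇ-refl : ∀ n → (n ℕ.≡ᵇ n) ≡ true
≡ᵇ-refl zero    = refl
≡ᵇ-refl (suc n) = ≡ᵇ-refl n

module _ {m n : ℕ} where

  ≡ᵇ-true : m ≡ n → (m ℕ.≡ᵇ n) ≡ true
  ≡ᵇ-true = dec-true (m ℕₚ.≟ n)

  ≡ᵇ-false : m ≢ n → (m ℕ.≡ᵇ n) ≡ false
  ≡ᵇ-false = dec-false (m ℕₚ.≟ n)

  ≡ᵇ-sound : (m ℕ.≡ᵇ n) ≡ true → m ≡ n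
  ≡ᵇ-sound e = ℕₚ.≡ᵇ⇒≡ m n (subst T (sym e) _)

  ≡ᵇ-false-sound : (m ℕ.≡ᵇ n) ≡ false → m ≢ n
  ≡ᵇ-false-sound e m≡n = contradiction (trans (sym (≡ᵇ-true m≡n)) e) λ ()

  <ᵇ-true : m < n → (m ℕ.<ᵇ n) ≡ true
  <ᵇ-true = dec-true (m ℕₚ.<? n)

  <ᵇ-false : n ≤ m → (m ℕ.<ᵇ n) ≡ false
  <ᵇ-false = dec-false (m ℕₚ.<? n) ∘ ℕₚ.≤⇒≯

eqListℕ-refl : ∀ xs → eqListℕ xs xs ≡ true
eqListℕ-refl []       = refl
eqListℕ-refl (x ∷ xs) rewrite ≡ᵇ-refl x = eqListℕ-refl xs

eqListℕ-sound : ∀ xs ys → eqListℕ xs ys ≡ true → xs ≡ ys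
eqListℕ-sound []       []       _ = refl
eqListℕ-sound (x ∷ xs) (y ∷ ys) e with x ℕ.≡ᵇ y in x≡ᵇy
... | true = cong₂ _∷_ (≡ᵇ-sound {x} {y} x≡ᵇy) (eqListℕ-sound xs ys e)

eqListℕ-false : ∀ xs ys → xs ≢ ys → eqListℕ xs ys ≡ false
eqListℕ-false xs ys xs≢ys with eqListℕ xs ys in e
... | true  = contradiction (eqListℕ-sound xs ys e) xs≢ys
... | false = refl

data Ascending : ℕ → List ℕ → Set where
  []  : ∀ {i} → Ascending i []
  _∷_ : ∀ {i j J} → i ≤ j → Ascending (suc j) J → Ascending i (j ∷ J)

data Sparse : ℕ → List ℕ → Set where
  []  : ∀ {i} → Sparse i []
  _∷_ : ∀ {i j J} → i ≤ j → Sparse (suc (suc j)) J → Sparse i (j ∷ J)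

Ascending-weaken : ∀ {i k J} → k ≤ i → Ascending i J → Ascending k J
Ascending-weaken k≤i []          = []
Ascending-weaken k≤i (i≤j ∷ asc) = ℕₚ.≤-trans k≤i i≤j ∷ asc

Sparse-weaken : ∀ {i k J} → k ≤ i → Sparse i J → Sparse k J
Sparse-weaken k≤i []             = []
Sparse-weaken k≤i (i≤j ∷ sparse) = ℕₚ.≤-trans k≤i i≤j ∷ sparse

Sparse⇒Ascending : ∀ {i J} → Sparse i J → Ascending i J
Sparse⇒Ascending []             = []
Sparse⇒Ascending (i≤j ∷ sparse) = i≤j ∷ Sparse⇒Ascending (Sparse-weaken (ℕₚ.n≤1+n _) sparse)

memℕ-Ascending-suc : ∀ i {J} → Ascending (suc i) J → memℕ i J ≡ false
memℕ-Ascending-suc i []          = refl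
memℕ-Ascending-suc i (i<j ∷ asc) rewrite ≡ᵇ-false (ℕₚ.<⇒≢ i<j) =
  memℕ-Ascending-suc i (Ascending-weaken (ℕₚ.m≤n⇒m≤1+n i<j) asc)

memℕ-∉ : ∀ x {J} → All (x ≢_) J → memℕ x J ≡ false
memℕ-∉ x []          = refl
memℕ-∉ x (x≢j ∷ x∉J) rewrite ≡ᵇ-false x≢j = memℕ-∉ x x∉J

memℕ-++ : ∀ x J₁ J₂ → memℕ x (J₁ ++ J₂) ≡ (memℕ x J₁ ∨ memℕ x J₂)
memℕ-++ x []       J₂ = refl
memℕ-++ x (j ∷ J₁) J₂ =
  trans (cong ((x ℕ.≡ᵇ j) ∨_) (memℕ-++ x J₁ J₂))
        (sym (Boolₚ.∨-assoc (x ℕ.≡ᵇ j) (memℕ x J₁) (memℕ x J₂)))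

interval : ℕ → ℕ → List ℕ
interval a zero    = []
interval a (suc k) = a ∷ interval (suc a) k

range≡interval : ∀ a k → range a k ≡ interval a k
range≡interval a k = trans (Listₚ.map-upTo (a ℕ.+_) k) (applyUpTo-interval (a ℕ.+_) a k (λ _ → refl))
  where
  applyUpTo-interval : ∀ f a k → (∀ i → f i ≡ a ℕ.+ i) → applyUpTo f k ≡ interval a k
  applyUpTo-interval f a zero    _   = refl
  applyUpTo-interval f a (suc k) f≗ = cong₂ _∷_ (trans (f≗ 0) (ℕₚ.+-identityʳ a))
    (applyUpTo-interval (f ∘ suc) (suc a) k (λ i → trans (f≗ (suc i)) (ℕₚ.+-suc a i)))

interval-++ : ∀ a k m → interval a (k ℕ.+ m) ≡ interval a k ++ interval (a ℕ.+ k) m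
interval-++ a zero    m = cong (λ b → interval b m) (sym (ℕₚ.+-identityʳ a))
interval-++ a (suc k) m =
  cong (a ∷_) (trans (interval-++ (suc a) k m) (cong (λ b → interval (suc a) k ++ interval b m) (sym (ℕₚ.+-suc a k))))

Ascending-interval : ∀ a k → Ascending a (interval a k)
Ascending-interval a zero    = []
Ascending-interval a (suc k) = ℕₚ.≤-refl ∷ Ascending-interval (suc a) k

∈-sublists-interval⇒Ascending : ∀ a k {J} → J ∈ sublists (interval a k) → Ascending a J
∈-sublists-interval⇒Ascending a zero    (here refl) = []
∈-sublists-interval⇒Ascending a (suc k) J∈ with ∈-++⁻ (map (a ∷_) (sublists (interval (suc a) k))) J∈
... | inj₁ J∈₁ with _ , J′∈ , refl ← ∈-map⁻ (a ∷_) J∈₁ =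
  ℕₚ.≤-refl ∷ ∈-sublists-interval⇒Ascending (suc a) k J′∈
... | inj₂ J∈₂ = Ascending-weaken (ℕₚ.n≤1+n a) (∈-sublists-interval⇒Ascending (suc a) k J∈₂)

∈-sublists-interval⇒bounded : ∀ a k {J} → J ∈ sublists (interval a k) → All (_< a ℕ.+ k) J
∈-sublists-interval⇒bounded a zero    (here refl) = []
∈-sublists-interval⇒bounded a (suc k) {J} J∈
  rewrite ℕₚ.+-suc a k with ∈-++⁻ (map (a ∷_) (sublists (interval (suc a) k))) J∈
... | inj₁ J∈₁ with _ , J′∈ , refl ← ∈-map⁻ (a ∷_) J∈₁ =
  s≤s (ℕₚ.m≤m+n a k) ∷ ∈-sublists-interval⇒bounded (suc a) k J′∈
... | inj₂ J∈₂ = ∈-sublists-interval⇒bounded (suc a) k J∈₂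

∑-sublists-∷ : ∀ x xs (g : List ℕ → ℚ) →
               ∑ (sublists (x ∷ xs)) g ≡ (∑[ J ∈ sublists xs ] g (x ∷ J)) + ∑ (sublists xs) g
∑-sublists-∷ x xs g =
  trans (∑-++ (map (x ∷_) (sublists xs)) (sublists xs) g) (cong (_+ _) (∑-map (x ∷_) (sublists xs) g))

∑-sublists-++ : ∀ xs ys (g : List ℕ → ℚ) →
                ∑ (sublists (xs ++ ys)) g ≡ (∑[ J₁ ∈ sublists xs ] ∑[ J₂ ∈ sublists ys ] g (J₁ ++ J₂))
∑-sublists-++ []       ys g = sym (ℚₚ.+-identityʳ _)
∑-sublists-++ (x ∷ xs) ys g = begin
  ∑ (sublists (x ∷ xs ++ ys)) g
    ≡⟨ ∑-sublists-∷ x (xs ++ ys) g ⟩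
  (∑[ J ∈ sublists (xs ++ ys) ] g (x ∷ J)) + ∑ (sublists (xs ++ ys)) g
    ≡⟨ cong₂ _+_ (∑-sublists-++ xs ys (g ∘ (x ∷_))) (∑-sublists-++ xs ys g) ⟩
  (∑[ J₁ ∈ sublists xs ] G (x ∷ J₁)) + (∑[ J₁ ∈ sublists xs ] G J₁)
    ≡⟨ ∑-sublists-∷ x xs G ⟨
  ∑ (sublists (x ∷ xs)) G ∎
  where
  open ≡-Reasoning
  G : List ℕ → ℚ
  G J₁ = ∑[ J₂ ∈ sublists ys ] g (J₁ ++ J₂)

∑-sublists-null : ∀ xs (h : List ℕ → ℚ) → (∑[ J ∈ sublists xs ] (⟦ null J ⟧ * h J)) ≡ h []
∑-sublists-null []       h = trans (ℚₚ.+-identityʳ _) (ℚₚ.*-identityˡ _)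
∑-sublists-null (x ∷ xs) h = begin
  ∑ (sublists (x ∷ xs)) (λ J → ⟦ null J ⟧ * h J)
    ≡⟨ ∑-sublists-∷ x xs _ ⟩
  (∑[ J ∈ sublists xs ] (0ℚ * h (x ∷ J))) + (∑[ J ∈ sublists xs ] (⟦ null J ⟧ * h J))
    ≡⟨ cong₂ _+_ (∑-zero (sublists xs) λ {J} _ → ℚₚ.*-zeroˡ (h (x ∷ J))) (∑-sublists-null xs h) ⟩
  0ℚ + h []
    ≡⟨ ℚₚ.+-identityˡ _ ⟩
  h [] ∎
  where open ≡-Reasoning

occurrences : List ℕ → List ℕ → ℚ
occurrences []      J       = 1ℚ
occurrences (d ∷ D) []      = 0ℚ
occurrences (d ∷ D) (x ∷ J) = (if d ℕ.≡ᵇ x then occurrences D J else 0ℚ) + occurrences (d ∷ D) J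

∑-sublists-eqListℕ : ∀ D J → (∑[ I ∈ sublists J ] ⟦ eqListℕ D I ⟧) ≡ occurrences D J
∑-sublists-eqListℕ []      []      = ℚₚ.+-identityʳ _
∑-sublists-eqListℕ (d ∷ D) []      = ℚₚ.+-identityʳ _
∑-sublists-eqListℕ []      (x ∷ J) = begin
  ∑ (sublists (x ∷ J)) (λ I → ⟦ eqListℕ [] I ⟧)
    ≡⟨ ∑-sublists-∷ x J _ ⟩
  (∑[ I ∈ sublists J ] 0ℚ) + ∑ (sublists J) (λ I → ⟦ eqListℕ [] I ⟧)
    ≡⟨ cong₂ _+_ (∑-zero (sublists J) (λ _ → refl)) (∑-sublists-eqListℕ [] J) ⟩
  0ℚ + 1ℚ
    ≡⟨ ℚₚ.+-identityˡ 1ℚ ⟩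
  1ℚ ∎
  where open ≡-Reasoning
∑-sublists-eqListℕ (d ∷ D) (x ∷ J) =
  trans (∑-sublists-∷ x J _) (cong₂ _+_ starting-with-x (∑-sublists-eqListℕ (d ∷ D) J))
  where
  starting-with-x : (∑[ I ∈ sublists J ] ⟦ (d ℕ.≡ᵇ x) ∧ eqListℕ D I ⟧)
                    ≡ (if d ℕ.≡ᵇ x then occurrences D J else 0ℚ)
  starting-with-x with d ℕ.≡ᵇ x
  ... | true  = ∑-sublists-eqListℕ D J
  ... | false = ∑-zero (sublists J) (λ _ → refl)

occurrences-absent : ∀ d D {J} → Ascending (suc d) J → occurrences (d ∷ D) J ≡ 0ℚ
occurrences-absent d D []          = refl
occurrences-absent d D (d<x ∷ asc) rewrite ≡ᵇ-false (ℕₚ.<⇒≢ d<x) =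
  trans (ℚₚ.+-identityˡ _) (occurrences-absent d D (Ascending-weaken (ℕₚ.m≤n⇒m≤1+n d<x) asc))

occurrences-skip : ∀ i {D} J → Ascending (suc i) D → occurrences D (i ∷ J) ≡ occurrences D J
occurrences-skip i J []          = refl
occurrences-skip i J (i<d ∷ asc) rewrite ≡ᵇ-false (ℕₚ.>⇒≢ i<d) = ℚₚ.+-identityˡ _

occurrences-interval : ∀ a k {Q} → Ascending a Q → All (_< a ℕ.+ k) Q → occurrences Q (interval a k) ≡ 1ℚ
occurrences-interval a k       []           _                = refl
occurrences-interval a zero    (a≤q ∷ _)   (q<a+0 ∷ _)
  = contradiction (ℕₚ.<-≤-trans q<a+0 (ℕₚ.≤-reflexive (ℕₚ.+-identityʳ a))) (ℕₚ.≤⇒≯ a≤q)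
occurrences-interval a (suc k) {q ∷ Q} (a≤q ∷ asc) (q<a+k ∷ Q<a+k)
  rewrite ℕₚ.+-suc a k with ℕₚ.m≤n⇒m<n∨m≡n a≤q
... | inj₁ a<q rewrite ≡ᵇ-false (ℕₚ.>⇒≢ a<q) =
  trans (ℚₚ.+-identityˡ _) (occurrences-interval (suc a) k (a<q ∷ asc) (q<a+k ∷ Q<a+k))
... | inj₂ refl rewrite ≡ᵇ-refl a =
  trans (cong₂ _+_ (occurrences-interval (suc a) k asc Q<a+k) (occurrences-absent a Q (Ascending-interval (suc a) k)))
        (ℚₚ.+-identityʳ 1ℚ)

headIs : List ℕ → ℕ → Bool
headIs []      i = false
headIs (j ∷ J) i = j ℕ.≡ᵇ i

-- 1 if every descent of prev · w, positions counted from i, lies in J, else 0.  J is taken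
-- ascending from i, so that i ∈ J exactly when J starts with i.
des⊆ : List ℕ → ℕ → ℤ → List ℤ → ℚ
des⊆ J i prev []      = 1ℚ
des⊆ J i prev (x ∷ w) =
  if headIs J i then des⊆ (drop 1 J) (suc i) x w
  else if ⌊ x ℤ.<? prev ⌋ then 0ℚ else des⊆ J (suc i) x w

Ascending-desGo : ∀ i prev w → Ascending i (desGo i prev w)
Ascending-desGo i prev []      = []
Ascending-desGo i prev (x ∷ w) with ⌊ x ℤ.<? prev ⌋
... | true  = ℕₚ.≤-refl ∷ Ascending-desGo (suc i) x w
... | false = Ascending-weaken (ℕₚ.n≤1+n i) (Ascending-desGo (suc i) x w)

occurrences-desGo : ∀ J i prev w → Ascending i J → occurrences (desGo i prev w) J ≡ des⊆ J i prev w
occurrences-desGo J       i prev []      _ = refl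
occurrences-desGo []      i prev (x ∷ w) _ with ⌊ x ℤ.<? prev ⌋
... | true  = refl
... | false = occurrences-desGo [] (suc i) x w []
occurrences-desGo (j ∷ J) i prev (x ∷ w) (i≤j ∷ asc) with j ℕ.≡ᵇ i in j≡ᵇi | ⌊ x ℤ.<? prev ⌋
... | true  | true with refl ← ≡ᵇ-sound {j} {i} j≡ᵇi rewrite ≡ᵇ-refl j =
  trans (cong₂ _+_ (occurrences-desGo J (suc j) x w asc) (occurrences-absent j _ asc)) (ℚₚ.+-identityʳ _)
... | true  | false with refl ← ≡ᵇ-sound {j} {i} j≡ᵇi =
  trans (occurrences-skip j J (Ascending-desGo (suc j) x w)) (occurrences-desGo J (suc j) x w asc)
... | false | true  = occurrences-absent i _ (i<j ∷ asc)
  where i<j = ℕₚ.≤∧≢⇒< i≤j (≡ᵇ-false-sound {j} {i} j≡ᵇi ∘ sym)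
... | false | false = occurrences-desGo (j ∷ J) (suc i) x w (i<j ∷ asc)
  where i<j = ℕₚ.≤∧≢⇒< i≤j (≡ᵇ-false-sound {j} {i} j≡ᵇi ∘ sym)

X≡des⊆ : ∀ J w → Ascending 0 J → X J w ≡ des⊆ J 0 (ℤ.+ 0) w
X≡des⊆ J w asc = trans (∑-sublists-eqListℕ (Des w) J) (occurrences-desGo J 0 (ℤ.+ 0) w asc)

∈-insertAll⇒↭ : ∀ x ys {z} → z ∈ insertAll x ys → z ↭ x ∷ ys
∈-insertAll⇒↭ x []       (here refl) = ↭-refl
∈-insertAll⇒↭ x (y ∷ ys) (here refl) = ↭-refl
∈-insertAll⇒↭ x (y ∷ ys) (there z∈) with z′ , z′∈ , refl ← ∈-map⁻ (y ∷_) z∈ =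
  ↭-trans (↭-prep y (∈-insertAll⇒↭ x ys z′∈)) (↭-swap y x ↭-refl)

∈-perms⇒↭ : ∀ xs {z} → z ∈ perms xs → z ↭ xs
∈-perms⇒↭ []       (here refl) = ↭-refl
∈-perms⇒↭ (x ∷ xs) z∈ with ys , ys∈ , z∈′ ← find (∈-concatMap⁻ (insertAll x) z∈) =
  ↭-trans (∈-insertAll⇒↭ x ys z∈′) (↭-prep x (∈-perms⇒↭ xs ys∈))

remove : ℕ → List ℕ → List ℕ
remove x []       = []
remove x (y ∷ ys) = if y ℕ.≡ᵇ x then ys else y ∷ remove x ys

remove-insertAll : ∀ x ys {z} → x ∉ ys → z ∈ insertAll x ys → remove x z ≡ ys
remove-insertAll x []       _    (here refl) rewrite ≡ᵇ-refl x = refl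
remove-insertAll x (y ∷ ys) _    (here refl) rewrite ≡ᵇ-refl x = refl
remove-insertAll x (y ∷ ys) x∉ (there z∈) with z′ , z′∈ , refl ← ∈-map⁻ (y ∷_) z∈
  rewrite ≡ᵇ-false (λ y≡x → x∉ (here (sym y≡x))) = cong (y ∷_) (remove-insertAll x ys (x∉ ∘ there) z′∈)

Unique-insertAll : ∀ x ys → x ∉ ys → Unique (insertAll x ys)
Unique-insertAll x []       _   = [] ∷ []
Unique-insertAll x (y ∷ ys) x∉ =
  All.tabulate head≢ ∷ Uniqueₚ.map⁺ Listₚ.∷-injectiveʳ (Unique-insertAll x ys (x∉ ∘ there))
  where
  head≢ : ∀ {z} → z ∈ map (y ∷_) (insertAll x ys) → x ∷ y ∷ ys ≢ z
  head≢ z∈ eq with _ , _ , refl ← ∈-map⁻ (y ∷_) z∈ = x∉ (here (Listₚ.∷-injectiveˡ eq))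

Unique-concatMap : (f : A → List B) {xs : List A} → Unique xs → (∀ {x} → x ∈ xs → Unique (f x)) →
                   (∀ {x y z} → x ∈ xs → y ∈ xs → z ∈ f x → z ∈ f y → x ≡ y) → Unique (concatMap f xs)
Unique-concatMap f {[]}     _             _     _       = []
Unique-concatMap f {x ∷ xs} (x∉xs ∷ uniq) f-uniq f-disj =
  Uniqueₚ.++⁺ (f-uniq (here refl))
    (Unique-concatMap f uniq (f-uniq ∘ there) (λ y∈ y′∈ → f-disj (there y∈) (there y′∈))) disjoint
  where
  disjoint : ∀ {z} → z ∈ f x × z ∈ concatMap f xs → ⊥
  disjoint (z∈fx , z∈) with y , y∈ , z∈fy ← find (∈-concatMap⁻ f z∈) =
    All.lookup x∉xs y∈ (f-disj (here refl) (there y∈) z∈fx z∈fy)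

Unique-perms : ∀ xs → Unique xs → Unique (perms xs)
Unique-perms []       _             = [] ∷ []
Unique-perms (x ∷ xs) (x∉xs ∷ uniq) =
  Unique-concatMap (insertAll x) (Unique-perms xs uniq) (λ ys∈ → Unique-insertAll x _ (x∉ ys∈))
    (λ ys∈ ys′∈ z∈ z∈′ → trans (sym (remove-insertAll x _ (x∉ ys∈) z∈))
                               (remove-insertAll x _ (x∉ ys′∈) z∈′))
  where
  x∉ : ∀ {ys} → ys ∈ perms xs → x ∉ ys
  x∉ ys∈ x∈ys = All.lookup x∉xs (∈-resp-↭ (∈-perms⇒↭ xs ys∈) x∈ys) refl

Unique-range : ∀ a k → Unique (range a k)
Unique-range a k = Uniqueₚ.map⁺ (ℕₚ.+-cancelˡ-≡ a _ _) (Uniqueₚ.upTo⁺ k)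

Unique-Sn : ∀ n → Unique (Sn n)
Unique-Sn n = Unique-perms (range 1 n) (Unique-range 1 n)

module _ {n σ} (σ∈ : σ ∈ Sn n) where

  length-Sn : length σ ≡ n
  length-Sn = trans (↭-length (∈-perms⇒↭ (range 1 n) σ∈))
    (trans (Listₚ.length-map (1 ℕ.+_) (upTo n)) (Listₚ.length-applyUpTo (λ i → i) n))

  positive-Sn : ∀ {e} → e ∈ σ → 1 ≤ e
  positive-Sn e∈ with _ , _ , refl ← ∈-map⁻ (1 ℕ.+_) (∈-resp-↭ (∈-perms⇒↭ (range 1 n) σ∈) e∈) = s≤s z≤n

  Unique-∈Sn : Unique σ
  Unique-∈Sn =
    Permutationₛ.Unique-resp-↭ (setoid ℕ) (↭⇒↭ₛ (↭-sym (∈-perms⇒↭ (range 1 n) σ∈))) (Unique-range 1 n)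

data Chain : ℕ → List ℕ → Set where
  []  : ∀ {a} → Chain a []
  _∷_ : ∀ {a b τ} → a ≢ suc b → Chain (suc b) τ → Chain a (suc b ∷ τ)

Unique⇒Chain : ∀ x τ → Unique (x ∷ τ) → All (1 ≤_) τ → Chain x τ
Unique⇒Chain x []          _                  _              = []
Unique⇒Chain x (suc b ∷ τ) ((x≢b ∷ _) ∷ uniq) (_ ∷ positive) = x≢b ∷ Unique⇒Chain (suc b) τ uniq positive

record FirstLetter (n : ℕ) (σ : List ℕ) : Set where
  field
    a     : ℕ
    τ     : List ℕ
    σ≡    : σ ≡ suc a ∷ τ
    chain : Chain (suc a) τ
    n≡    : n ≡ suc (length τ)

firstLetter : ∀ {n σ} → 1 ≤ n → σ ∈ Sn n → FirstLetter n σ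
firstLetter {n} {σ} 1≤n σ∈ = split σ (length-Sn {n} σ∈) (positive-Sn {n} σ∈) (Unique-∈Sn {n} σ∈)
  where
  split : ∀ σ → length σ ≡ n → (∀ {e} → e ∈ σ → 1 ≤ e) → Unique σ → FirstLetter n σ
  split []        refl _        _    = contradiction 1≤n λ ()
  split (zero ∷ τ) _   positive _    = contradiction (positive (here refl)) λ ()
  split (suc a ∷ τ) len positive uniq = record
    { a = a ; τ = τ ; σ≡ = refl
    ; chain = Unique⇒Chain (suc a) τ uniq (All.tabulate (positive ∘ there))
    ; n≡ = sym len
    }

∑-signings-∷ : ∀ k ks (h : List ℤ → ℚ) →
               ∑ (signings (k ∷ ks)) h ≡ (∑[ s ∈ signings ks ] (h (ℤ.+ k ∷ s) + h (ℤ.- (ℤ.+ k) ∷ s)))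
∑-signings-∷ k ks h = trans (∑-concatMap (λ s → (ℤ.+ k ∷ s) ∷ (ℤ.- (ℤ.+ k) ∷ s) ∷ []) (signings ks) h)
  (∑-cong (signings ks) λ {s} _ → cong (h (ℤ.+ k ∷ s) +_) (ℚₚ.+-identityʳ _))

∈-signings⇒∣∣ : ∀ τ {w} → w ∈ signings τ → map ∣_∣ w ≡ τ
∈-signings⇒∣∣ []       (here refl) = refl
∈-signings⇒∣∣ (k ∷ ks) w∈
  with find (∈-concatMap⁻ (λ s → (ℤ.+ k ∷ s) ∷ (ℤ.- (ℤ.+ k) ∷ s) ∷ []) {xs = signings ks} w∈)
... | s , s∈ , here refl         = cong (k ∷_) (∈-signings⇒∣∣ ks s∈)
... | s , s∈ , there (here refl) = cong₂ _∷_ (ℤₚ.∣-i∣≡∣i∣ (ℤ.+ k)) (∈-signings⇒∣∣ ks s∈)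

∑-eqListℕ-Unique : ∀ {L} σ → Unique L → σ ∈ L → (∑[ τ ∈ L ] ⟦ eqListℕ τ σ ⟧) ≡ 1ℚ
∑-eqListℕ-Unique σ (σ∉L ∷ uniq) (here refl) rewrite eqListℕ-refl σ = trans
  (cong (1ℚ +_) (∑-zero _ λ τ∈ → cong ⟦_⟧ (eqListℕ-false _ σ λ τ≡σ → All.lookup σ∉L τ∈ (sym τ≡σ))))
  (ℚₚ.+-identityʳ 1ℚ)
∑-eqListℕ-Unique {τ ∷ _} σ (τ∉L ∷ uniq) (there σ∈)
  rewrite eqListℕ-false τ σ (λ { refl → All.lookup τ∉L σ∈ refl }) =
  trans (ℚₚ.+-identityˡ _) (∑-eqListℕ-Unique σ uniq σ∈)

φ-signings : ∀ n (x : QB) {σ} → σ ∈ Sn n → φ n x σ ≡ ∑ (signings σ) x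
φ-signings n x {σ} σ∈ = begin
  φ n x σ
    ≡⟨ ∑-filter (λ w → eqListℕ (map ∣_∣ w) σ) (Bn n) x ⟩
  (∑[ w ∈ concatMap signings (Sn n) ] (⟦ eqListℕ (map ∣_∣ w) σ ⟧ * x w))
    ≡⟨ ∑-concatMap signings (Sn n) _ ⟩
  (∑[ τ ∈ Sn n ] ∑[ w ∈ signings τ ] (⟦ eqListℕ (map ∣_∣ w) σ ⟧ * x w))
    ≡⟨ ∑-cong (Sn n) (λ {τ} _ →
         trans (∑-cong (signings τ) (λ {w} w∈ → cong (λ v → ⟦ eqListℕ v σ ⟧ * x w) (∈-signings⇒∣∣ τ w∈)))
               (∑-*ˡ (signings τ) ⟦ eqListℕ τ σ ⟧ x)) ⟩
  (∑[ τ ∈ Sn n ] (⟦ eqListℕ τ σ ⟧ * S τ))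
    ≡⟨ ∑-cong (Sn n) (λ {τ} _ → only-σ τ) ⟩
  (∑[ τ ∈ Sn n ] (⟦ eqListℕ τ σ ⟧ * S σ))
    ≡⟨ ∑-*ʳ (Sn n) (S σ) _ ⟩
  (∑[ τ ∈ Sn n ] ⟦ eqListℕ τ σ ⟧) * S σ
    ≡⟨ cong (_* S σ) (∑-eqListℕ-Unique σ (Unique-Sn n) σ∈) ⟩
  1ℚ * S σ
    ≡⟨ ℚₚ.*-identityˡ _ ⟩
  S σ ∎
  where
  open ≡-Reasoning
  S : List ℕ → ℚ
  S τ = ∑ (signings τ) x
  only-σ : ∀ τ → ⟦ eqListℕ τ σ ⟧ * S τ ≡ ⟦ eqListℕ τ σ ⟧ * S σ
  only-σ τ with eqListℕ τ σ in e
  ... | true  = cong (λ v → 1ℚ * S v) (eqListℕ-sound τ σ e)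
  ... | false = trans (ℚₚ.*-zeroˡ (S τ)) (sym (ℚₚ.*-zeroˡ (S σ)))

peakGo-descent : ∀ k {b c} r → c < b → peakGo k (b ∷ c ∷ r) ≡ peakGo (suc k) (c ∷ r)
peakGo-descent k []      c<b = refl
peakGo-descent k (d ∷ r) c<b rewrite <ᵇ-false (ℕₚ.<⇒≤ c<b) = refl

Sparse-peakGo : ∀ k τ → Sparse (suc k) (peakGo k τ)
Sparse-peakGo k []              = []
Sparse-peakGo k (a ∷ [])        = []
Sparse-peakGo k (a ∷ b ∷ [])    = []
Sparse-peakGo k (a ∷ b ∷ c ∷ r) =
  step (a ℕ.<ᵇ b) (ℕₚ.<ᵇ-reflects-< c b) (Sparse-peakGo (suc k) (b ∷ c ∷ r)) (Sparse-peakGo (suc (suc k)) (c ∷ r))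
  where
  later = peakGo (suc k) (b ∷ c ∷ r)
  step : ∀ x {y} → Reflects (c < b) y → Sparse (2 ℕ.+ k) later → Sparse (3 ℕ.+ k) (peakGo (2 ℕ.+ k) (c ∷ r)) →
         Sparse (suc k) (if x ∧ y then suc k ∷ later else later)
  step false _         sparse _       = Sparse-weaken (ℕₚ.n≤1+n _) sparse
  step true  (ofⁿ _)   sparse _       = Sparse-weaken (ℕₚ.n≤1+n _) sparse
  step true  (ofʸ c<b) _      sparse′ = ℕₚ.≤-refl ∷ subst (Sparse (3 ℕ.+ k)) (sym (peakGo-descent (suc k) r c<b)) sparse′

All-if : ∀ {P : ℕ → Set} x {p L} → P p → All P L → All P (if x then p ∷ L else L)
All-if true  pp pL = pp ∷ pL
All-if false pp pL = pL

peakGo-bounded : ∀ k a τ → All (_< k ℕ.+ length τ) (peakGo k (a ∷ τ))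
peakGo-bounded k a []          = []
peakGo-bounded k a (b ∷ [])    = []
peakGo-bounded k a (b ∷ c ∷ r) = All-if ((a ℕ.<ᵇ b) ∧ (c ℕ.<ᵇ b)) k+1<k+|bcr|
  (subst (λ m → All (_< m) (peakGo (suc k) (b ∷ c ∷ r))) (sym (ℕₚ.+-suc k (length (c ∷ r))))
         (peakGo-bounded (suc k) b (c ∷ r)))
  where
  k+1<k+|bcr| : suc k < k ℕ.+ length (b ∷ c ∷ r)
  k+1<k+|bcr| rewrite ℕₚ.+-suc k (suc (length r)) | ℕₚ.+-suc k (length r) = s≤s (s≤s (ℕₚ.m≤m+n k _))

Ascending⇒All≤ : ∀ {m L} → Ascending m L → All (m ≤_) L
Ascending⇒All≤ []          = []
Ascending⇒All≤ (m≤j ∷ asc) = m≤j ∷ All.map (ℕₚ.≤-trans (ℕₚ.≤-trans m≤j (ℕₚ.n≤1+n _))) (Ascending⇒All≤ asc)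

covered : List ℕ → ℕ → Bool
covered J p = memℕ (p ∸ 1) J ∨ memℕ p J

covers : List ℕ → List ℕ → Bool
covers J []      = true
covers J (p ∷ Q) = covered J p ∧ covers J Q

covers-cong : ∀ {P : ℕ → Set} {J J′ Q} → All P Q → (∀ {p} → P p → covered J p ≡ covered J′ p) →
              covers J Q ≡ covers J′ Q
covers-cong []         _   = refl
covers-cong (pq ∷ pQ) J≗J′ = cong₂ _∧_ (J≗J′ pq) (covers-cong pQ J≗J′)

covers-++ : ∀ J Q₁ Q₂ → covers J (Q₁ ++ Q₂) ≡ (covers J Q₁ ∧ covers J Q₂)
covers-++ J []       Q₂ = refl
covers-++ J (q ∷ Q₁) Q₂ =
  trans (cong (covered J q ∧_) (covers-++ J Q₁ Q₂)) (sym (Boolₚ.∧-assoc (covered J q) (covers J Q₁) (covers J Q₂)))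

memℕ-headIs : ∀ k {J} → Ascending k J → memℕ k J ≡ headIs J k
memℕ-headIs k []          = refl
memℕ-headIs k (k≤j ∷ asc) with ℕₚ.m≤n⇒m<n∨m≡n k≤j
... | inj₁ k<j rewrite ≡ᵇ-false (ℕₚ.<⇒≢ k<j) | ≡ᵇ-false (ℕₚ.>⇒≢ k<j) =
  memℕ-Ascending-suc k (Ascending-weaken (ℕₚ.m≤n⇒m≤1+n k<j) asc)
... | inj₂ refl rewrite ≡ᵇ-refl k = refl

covered-drop : ∀ i J {p} → suc (suc i) ≤ p → covered (i ∷ J) p ≡ covered J p
covered-drop i J {suc (suc q)} (s≤s (s≤s i≤q))
  rewrite ≡ᵇ-false (ℕₚ.>⇒≢ (s≤s i≤q)) | ≡ᵇ-false (ℕₚ.>⇒≢ (s≤s (ℕₚ.m≤n⇒m≤1+n i≤q))) = refl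

covers-drop-peakGo : ∀ i J τ → covers (i ∷ J) (peakGo (suc i) τ) ≡ covers J (peakGo (suc i) τ)
covers-drop-peakGo i J τ = covers-cong (Ascending⇒All≤ (Sparse⇒Ascending (Sparse-peakGo (suc i) τ))) (covered-drop i J)

covers-peakGo-cut : ∀ i J a b τ → covers (i ∷ J) (peakGo i (a ∷ b ∷ τ)) ≡ covers J (peakGo (suc i) (b ∷ τ))
covers-peakGo-cut i J a b []      = refl
covers-peakGo-cut i J a b (c ∷ r) with (a ℕ.<ᵇ b) ∧ (c ℕ.<ᵇ b)
... | true  rewrite ≡ᵇ-refl i = covers-drop-peakGo i J (b ∷ c ∷ r)
... | false = covers-drop-peakGo i J (b ∷ c ∷ r)

nextAbove : ℕ → List ℕ → Bool
nextAbove a []      = true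
nextAbove a (b ∷ _) = a ℕ.<ᵇ b

nextBelow : ℕ → List ℕ → Bool
nextBelow a []      = false
nextBelow a (b ∷ _) = b ℕ.<ᵇ a

covers-peakGo-ascent : ∀ J i {a b} τ → Ascending (suc i) J → a < b → Chain (suc b) τ →
  (covers J (peakGo (suc i) (suc b ∷ τ)) ∧ (headIs J (suc i) ∨ nextAbove (suc b) τ))
  ≡ covers J (peakGo i (suc a ∷ suc b ∷ τ))
covers-peakGo-ascent J i []          asc a<b []                = Boolₚ.∨-zeroʳ (headIs J (suc i))
covers-peakGo-ascent J i {b = b} (suc c ∷ r) asc a<b (b≢c ∷ _) rewrite <ᵇ-true a<b with ℕₚ.<-cmp c b
... | tri< c<b _ _ rewrite <ᵇ-true c<b | <ᵇ-false (ℕₚ.<⇒≤ c<b)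
                         | memℕ-Ascending-suc i asc | memℕ-headIs (suc i) asc =
  trans (cong (covers J later ∧_) (Boolₚ.∨-identityʳ (headIs J (suc i)))) (Boolₚ.∧-comm _ (headIs J (suc i)))
  where later = peakGo (suc i) (suc b ∷ suc c ∷ r)
... | tri≈ _ c≡b _ = contradiction (cong suc (sym c≡b)) b≢c
... | tri> _ _ b<c rewrite <ᵇ-false (ℕₚ.<⇒≤ b<c) | <ᵇ-true b<c =
  trans (cong (covers J later ∧_) (Boolₚ.∨-zeroʳ (headIs J (suc i)))) (Boolₚ.∧-identityʳ _)
  where later = peakGo (suc i) (suc b ∷ suc c ∷ r)

covers-peakGo-descent : ∀ J i {a b} τ → b < a → covers J (peakGo i (a ∷ b ∷ τ)) ≡ covers J (peakGo (suc i) (b ∷ τ))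
covers-peakGo-descent J i []      b<a = refl
covers-peakGo-descent J i (c ∷ r) b<a rewrite <ᵇ-false (ℕₚ.<⇒≤ b<a) = refl

2ℚ : ℚ
2ℚ = 1ℚ + 1ℚ

-- weight J i L = 2 ^ |J ∩ [i, i + L)| when J is ascending from i.
weight : List ℕ → ℕ → ℕ → ℚ
weight J i zero    = 1ℚ
weight J i (suc L) = if headIs J i then 2ℚ * weight (drop 1 J) (suc i) L else weight J (suc i) L

signedCount : List ℕ → ℕ → ℤ → List ℕ → ℚ
signedCount J i prev τ = ∑ (signings τ) (des⊆ J i prev)

afterPositive : List ℕ → ℕ → ℕ → List ℕ → ℚ
afterPositive J i a τ = ⟦ headIs J i ∨ nextAbove a τ ⟧

afterNegative : List ℕ → ℕ → ℕ → List ℕ → ℚ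
afterNegative J i a τ = 1ℚ + ⟦ not (headIs J i) ∧ nextBelow a τ ⟧

afterPositive+afterNegative : ∀ J i b τ → Chain (suc b) τ → afterPositive J i (suc b) τ + afterNegative J i (suc b) τ ≡ 2ℚ
afterPositive+afterNegative J i b τ chain with headIs J i
afterPositive+afterNegative J i b τ           chain       | true  = refl
afterPositive+afterNegative J i b []          []          | false = refl
afterPositive+afterNegative J i b (suc c ∷ τ) (b≢c ∷ _) | false with ℕₚ.<-cmp b c
... | tri< b<c _ _ rewrite <ᵇ-true b<c | <ᵇ-false (ℕₚ.<⇒≤ b<c) = refl
... | tri≈ _ b≡c _ = contradiction (cong suc b≡c) b≢c
... | tri> _ _ c<b rewrite <ᵇ-false (ℕₚ.<⇒≤ c<b) | <ᵇ-true c<b = refl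

-- Counting the signings of τ that follow the letter ±(a + 1) with all descents in J: the peaks of
-- (a + 1) · τ must be covered by J, each position of J doubles the count, and the first position
-- contributes a factor depending on the sign of the letter before it.
SignedCounts : List ℕ → ℕ → ℕ → List ℕ → Set
SignedCounts J i a τ =
  signedCount J i (ℤ.+ suc a) τ ≡ base * afterPositive J i (suc a) τ ×
  signedCount J i -[1+ a ] τ ≡ base * afterNegative J i (suc a) τ
  where base = weight J i (length τ) * ⟦ covers J (peakGo i (suc a ∷ τ)) ⟧

signedCount-cut : ∀ J i prev k τ → headIs J i ≡ true →
  signedCount J i prev (k ∷ τ) ≡ signedCount (drop 1 J) (suc i) (ℤ.+ k) τ + signedCount (drop 1 J) (suc i) (ℤ.- (ℤ.+ k)) τ
signedCount-cut J i prev k τ cut = trans (∑-signings-∷ k τ (des⊆ J i prev))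
  (trans (∑-cong (signings τ) λ {s} _ → cong₂ _+_ (des⊆-cut (ℤ.+ k) {s}) (des⊆-cut (ℤ.- (ℤ.+ k)) {s}))
         (∑-+ (signings τ) _ _))
  where
  des⊆-cut : ∀ x {s} → des⊆ J i prev (x ∷ s) ≡ des⊆ (drop 1 J) (suc i) x s
  des⊆-cut x rewrite cut = refl

guarded : List ℕ → ℕ → ℤ → ℤ → List ℤ → ℚ
guarded J i prev x s = if ⌊ x ℤ.<? prev ⌋ then 0ℚ else des⊆ J (suc i) x s

signedCount-nocut : ∀ J i prev k τ → headIs J i ≡ false →
  signedCount J i prev (k ∷ τ) ≡ (∑[ s ∈ signings τ ] (guarded J i prev (ℤ.+ k) s + guarded J i prev (ℤ.- (ℤ.+ k)) s))
signedCount-nocut J i prev k τ nocut = trans (∑-signings-∷ k τ (des⊆ J i prev))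
  (∑-cong (signings τ) λ {s} _ → cong₂ _+_ (des⊆-nocut (ℤ.+ k) {s}) (des⊆-nocut (ℤ.- (ℤ.+ k)) {s}))
  where
  des⊆-nocut : ∀ x {s} → des⊆ J i prev (x ∷ s) ≡ guarded J i prev x s
  des⊆-nocut x rewrite nocut = refl

bothSigns : ∀ J i b τ → Chain (suc b) τ → SignedCounts J i b τ →
  signedCount J i (ℤ.+ suc b) τ + signedCount J i -[1+ b ] τ
  ≡ (weight J i (length τ) * ⟦ covers J (peakGo i (suc b ∷ τ)) ⟧) * 2ℚ
bothSigns J i b τ chain (count₊ , count₋) = begin
  signedCount J i (ℤ.+ suc b) τ + signedCount J i -[1+ b ] τ
    ≡⟨ cong₂ _+_ count₊ count₋ ⟩
  base * afterPositive J i (suc b) τ + base * afterNegative J i (suc b) τ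
    ≡⟨ ℚₚ.*-distribˡ-+ base _ _ ⟨
  base * (afterPositive J i (suc b) τ + afterNegative J i (suc b) τ)
    ≡⟨ cong (base *_) (afterPositive+afterNegative J i b τ chain) ⟩
  base * 2ℚ ∎
  where
  open ≡-Reasoning
  base = weight J i (length τ) * ⟦ covers J (peakGo i (suc b ∷ τ)) ⟧

signedCounts-cut : ∀ i J a b τ → Chain (suc b) τ → SignedCounts J (suc i) b τ → SignedCounts (i ∷ J) i a (suc b ∷ τ)
signedCounts-cut i J a b τ chain counts
  rewrite ≡ᵇ-refl i | covers-peakGo-cut i J (suc a) (suc b) τ =
  trans (both (ℤ.+ suc a)) reorder , trans (both -[1+ a ]) reorder
  where
  w = weight J (suc i) (length τ)
  t = ⟦ covers J (peakGo (suc i) (suc b ∷ τ)) ⟧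
  both : ∀ prev → signedCount (i ∷ J) i prev (suc b ∷ τ) ≡ (w * t) * 2ℚ
  both prev = trans (signedCount-cut (i ∷ J) i prev (suc b) τ (≡ᵇ-refl i)) (bothSigns J (suc i) b τ chain counts)
  reorder : (w * t) * 2ℚ ≡ ((2ℚ * w) * t) * 1ℚ
  reorder = solve 2 (λ w t → (w :* t) :* con 2ℚ := ((con 2ℚ :* w) :* t) :* con 1ℚ) refl w t

guarded-ascent : ∀ {J i prev x s} → ⌊ x ℤ.<? prev ⌋ ≡ false → guarded J i prev x s ≡ des⊆ J (suc i) x s
guarded-ascent ascent rewrite ascent = refl

guarded-descent : ∀ {J i prev x s} → ⌊ x ℤ.<? prev ⌋ ≡ true → guarded J i prev x s ≡ 0ℚ
guarded-descent descent rewrite descent = refl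

<?-positive : ∀ b a → ⌊ ℤ.+ suc b ℤ.<? ℤ.+ suc a ⌋ ≡ (b ℕ.<ᵇ a)
<?-positive b a = isYes≗does (ℤ.+ suc b ℤ.<? ℤ.+ suc a)

<?-negative : ∀ b a → ⌊ -[1+ b ] ℤ.<? -[1+ a ] ⌋ ≡ (a ℕ.<ᵇ b)
<?-negative b a = isYes≗does (-[1+ b ] ℤ.<? -[1+ a ])

signedCounts-ascent : ∀ J i a b τ → headIs J i ≡ false → Ascending (suc i) J → a < b → Chain (suc b) τ →
                      SignedCounts J (suc i) b τ → SignedCounts J i a (suc b ∷ τ)
signedCounts-ascent J i a b τ nocut asc a<b chain (count₊ , _)
  rewrite nocut | <ᵇ-true a<b | <ᵇ-false (ℕₚ.<⇒≤ a<b) | sym (covers-peakGo-ascent J i τ asc a<b chain)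
        | ⟦∧⟧ (covers J (peakGo (suc i) (suc b ∷ τ))) (headIs J (suc i) ∨ nextAbove (suc b) τ) =
  trans (onlyPositive (ℤ.+ suc a) (trans (<?-positive b a) (<ᵇ-false (ℕₚ.<⇒≤ a<b))) refl) (trans count₊ reassoc) ,
  trans (onlyPositive -[1+ a ] refl (trans (<?-negative b a) (<ᵇ-true a<b))) (trans count₊ reassoc)
  where
  w = weight J (suc i) (length τ)
  t = ⟦ covers J (peakGo (suc i) (suc b ∷ τ)) ⟧
  p = afterPositive J (suc i) (suc b) τ
  reassoc : (w * t) * p ≡ (w * (t * p)) * 1ℚ
  reassoc = solve 3 (λ w t p → (w :* t) :* p := (w :* (t :* p)) :* con 1ℚ) refl w t p
  onlyPositive : ∀ prev → ⌊ ℤ.+ suc b ℤ.<? prev ⌋ ≡ false → ⌊ -[1+ b ] ℤ.<? prev ⌋ ≡ true →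
                 signedCount J i prev (suc b ∷ τ) ≡ signedCount J (suc i) (ℤ.+ suc b) τ
  onlyPositive prev ascent descent = trans (signedCount-nocut J i prev (suc b) τ nocut)
    (∑-cong (signings τ) λ {s} _ →
      trans (cong₂ _+_ (guarded-ascent {J} {i} {s = s} ascent) (guarded-descent {J} {i} {s = s} descent))
            (ℚₚ.+-identityʳ _))

signedCounts-descent : ∀ J i a b τ → headIs J i ≡ false → b < a → Chain (suc b) τ →
                       SignedCounts J (suc i) b τ → SignedCounts J i a (suc b ∷ τ)
signedCounts-descent J i a b τ nocut b<a chain counts
  rewrite nocut | <ᵇ-false (ℕₚ.<⇒≤ b<a) | <ᵇ-true b<a | covers-peakGo-descent J i τ (s≤s b<a) =
  trans noneAllowed (sym (ℚₚ.*-zeroʳ (weight J (suc i) (length τ) * ⟦ covers J (peakGo (suc i) (suc b ∷ τ)) ⟧))) ,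
  trans bothAllowed (bothSigns J (suc i) b τ chain counts)
  where
  noneAllowed : signedCount J i (ℤ.+ suc a) (suc b ∷ τ) ≡ 0ℚ
  noneAllowed = trans (signedCount-nocut J i (ℤ.+ suc a) (suc b) τ nocut) (∑-zero (signings τ) λ {s} _ →
    cong₂ _+_ (guarded-descent {J} {i} {s = s} (trans (<?-positive b a) (<ᵇ-true b<a))) refl)
  bothAllowed : signedCount J i -[1+ a ] (suc b ∷ τ) ≡ signedCount J (suc i) (ℤ.+ suc b) τ + signedCount J (suc i) -[1+ b ] τ
  bothAllowed = trans (signedCount-nocut J i -[1+ a ] (suc b) τ nocut)
    (trans (∑-cong (signings τ) (λ {s} _ → cong (guarded J i -[1+ a ] (ℤ.+ suc b) s +_)
                                              (guarded-ascent {J} {i} {s = s} (trans (<?-negative b a) (<ᵇ-false (ℕₚ.<⇒≤ b<a))))))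
           (∑-+ (signings τ) _ _))

signedCounts-nocut : ∀ J i a b τ → headIs J i ≡ false → Ascending (suc i) J → a ≢ b → Chain (suc b) τ →
                     SignedCounts J (suc i) b τ → SignedCounts J i a (suc b ∷ τ)
signedCounts-nocut J i a b τ nocut asc a≢b chain counts with ℕₚ.<-cmp a b
... | tri< a<b _ _ = signedCounts-ascent J i a b τ nocut asc a<b chain counts
... | tri≈ _ a≡b _ = contradiction a≡b a≢b
... | tri> _ _ b<a = signedCounts-descent J i a b τ nocut b<a chain counts

signedCounts : ∀ J i a τ → Ascending i J → Chain (suc a) τ → SignedCounts J i a τ
signedCounts J i a [] asc []
  rewrite Boolₚ.∨-zeroʳ (headIs J i) | Boolₚ.∧-zeroʳ (not (headIs J i)) = refl , refl
signedCounts [] i a (suc b ∷ τ) [] (a≢b ∷ chain) =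
  signedCounts-nocut [] i a b τ refl [] (a≢b ∘ cong suc) chain (signedCounts [] (suc i) b τ [] chain)
signedCounts (j ∷ J) i a (suc b ∷ τ) (i≤j ∷ asc) (a≢b ∷ chain) with j ℕₚ.≟ i
... | yes refl = signedCounts-cut j J a b τ chain (signedCounts J (suc j) b τ asc chain)
... | no  j≢i  = signedCounts-nocut (j ∷ J) i a b τ (≡ᵇ-false j≢i) asc′ (a≢b ∘ cong suc) chain
                   (signedCounts (j ∷ J) (suc i) b τ asc′ chain)
  where asc′ = ℕₚ.≤∧≢⇒< i≤j (j≢i ∘ sym) ∷ asc

data Generator : List ℕ → Set where
  0∷_ : ∀ {J} → Ascending 1 J → Generator (0 ∷ J)
  1∷_ : ∀ {J} → Ascending 2 J → Generator (1 ∷ J)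

covers-0∷ : ∀ J {Q} → Sparse 2 Q → covers (0 ∷ J) Q ≡ covers J Q
covers-0∷ J sparse = covers-cong (Ascending⇒All≤ (Sparse⇒Ascending sparse)) (covered-drop 0 J)

signedCount-generator : ∀ {K a τ} → Generator K → Chain (suc a) τ →
  signedCount K 0 (ℤ.+ 0) (suc a ∷ τ) ≡ weight K 0 (suc (length τ)) * ⟦ covers K (peakGo 1 (suc a ∷ τ)) ⟧
signedCount-generator {0 ∷ J} {a} {τ} (0∷ asc) chain = begin
  signedCount (0 ∷ J) 0 (ℤ.+ 0) (suc a ∷ τ)
    ≡⟨ signedCount-cut (0 ∷ J) 0 (ℤ.+ 0) (suc a) τ refl ⟩
  signedCount J 1 (ℤ.+ suc a) τ + signedCount J 1 -[1+ a ] τ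
    ≡⟨ bothSigns J 1 a τ chain (signedCounts J 1 a τ asc chain) ⟩
  (weight J 1 (length τ) * ⟦ covers J Q ⟧) * 2ℚ
    ≡⟨ solve 2 (λ w c → (w :* c) :* con 2ℚ := (con 2ℚ :* w) :* c) refl (weight J 1 (length τ)) ⟦ covers J Q ⟧ ⟩
  (2ℚ * weight J 1 (length τ)) * ⟦ covers J Q ⟧
    ≡⟨ cong (λ c → (2ℚ * weight J 1 (length τ)) * ⟦ c ⟧) (covers-0∷ J (Sparse-peakGo 1 (suc a ∷ τ))) ⟨
  weight (0 ∷ J) 0 (suc (length τ)) * ⟦ covers (0 ∷ J) Q ⟧ ∎
  where
  open ≡-Reasoning
  Q = peakGo 1 (suc a ∷ τ)
signedCount-generator {1 ∷ J} {a} {τ} (1∷ asc) chain = begin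
  signedCount (1 ∷ J) 0 (ℤ.+ 0) (suc a ∷ τ)
    ≡⟨ signedCount-nocut (1 ∷ J) 0 (ℤ.+ 0) (suc a) τ refl ⟩
  (∑[ s ∈ signings τ ] (des⊆ (1 ∷ J) 1 (ℤ.+ suc a) s + 0ℚ))
    ≡⟨ ∑-cong (signings τ) (λ _ → ℚₚ.+-identityʳ _) ⟩
  signedCount (1 ∷ J) 1 (ℤ.+ suc a) τ
    ≡⟨ proj₁ (signedCounts (1 ∷ J) 1 a τ (ℕₚ.≤-refl ∷ asc) chain) ⟩
  weight (1 ∷ J) 0 (suc (length τ)) * ⟦ covers (1 ∷ J) (peakGo 1 (suc a ∷ τ)) ⟧ * 1ℚ
    ≡⟨ ℚₚ.*-identityʳ _ ⟩
  weight (1 ∷ J) 0 (suc (length τ)) * ⟦ covers (1 ∷ J) (peakGo 1 (suc a ∷ τ)) ⟧ ∎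
  where open ≡-Reasoning

φ-X : ∀ {n K σ} → 1 ≤ n → Generator K → σ ∈ Sn n → φ n (X K) σ ≡ weight K 0 n * ⟦ covers K (Peak σ) ⟧
φ-X {n} {K} {σ} 1≤n gen σ∈ with firstLetter 1≤n σ∈
... | record { a = a ; τ = τ ; σ≡ = refl ; chain = chain ; n≡ = refl } = begin
  φ n (X K) (suc a ∷ τ)
    ≡⟨ φ-signings n (X K) σ∈ ⟩
  ∑ (signings (suc a ∷ τ)) (X K)
    ≡⟨ ∑-cong (signings (suc a ∷ τ)) (λ {w} _ → X≡des⊆ K w (Ascending-generator gen)) ⟩
  signedCount K 0 (ℤ.+ 0) (suc a ∷ τ)
    ≡⟨ signedCount-generator gen chain ⟩
  weight K 0 n * ⟦ covers K (Peak σ) ⟧ ∎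
  where
  open ≡-Reasoning
  Ascending-generator : ∀ {K} → Generator K → Ascending 0 K
  Ascending-generator (0∷ asc) = z≤n ∷ asc
  Ascending-generator (1∷ asc) = z≤n ∷ asc

Peak-bounded : ∀ {n σ} → 1 ≤ n → σ ∈ Sn n → All (_< n) (Peak σ)
Peak-bounded 1≤n σ∈ with firstLetter 1≤n σ∈
... | record { a = a ; τ = τ ; σ≡ = refl ; n≡ = refl } = peakGo-bounded 1 (suc a) τ

Sparse⇒noConsec : ∀ {i Q} → Sparse i Q → noConsec Q ≡ true
Sparse⇒noConsec []                        = refl
Sparse⇒noConsec (_ ∷ [])                  = refl
Sparse⇒noConsec (_ ∷ sparse@(j+2≤k ∷ _)) =
  cong₂ (λ x y → not x ∧ y) (≡ᵇ-false (ℕₚ.<⇒≢ j+2≤k)) (Sparse⇒noConsec sparse)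

noConsec⇒Sparse : ∀ {i Q} → Ascending i Q → noConsec Q ≡ true → Sparse i Q
noConsec⇒Sparse []                         _  = []
noConsec⇒Sparse (i≤j ∷ [])                 _  = i≤j ∷ []
noConsec⇒Sparse {Q = j ∷ k ∷ Q} (i≤j ∷ j<k ∷ asc) nc =
  i≤j ∷ noConsec⇒Sparse (ℕₚ.≤∧≢⇒< j<k (≡ᵇ-false-sound {suc j} {k} j+1≢ᵇk) ∷ asc) (Boolₚ.∧-conicalʳ _ _ nc)
  where
  j+1≢ᵇk : (suc j ℕ.≡ᵇ k) ≡ false
  j+1≢ᵇk = trans (sym (Boolₚ.not-involutive _)) (cong not (Boolₚ.∧-conicalˡ _ _ nc))

∈Fn⇒Sparse : ∀ {n F} → F ∈ Fn n → Sparse 2 F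
∈Fn⇒Sparse {n} F∈ with F∈′ , nc ← ∈-filter⁻ (λ F → T? (noConsec F)) {xs = sublists (range 2 (n ∸ 2))} F∈ =
  noConsec⇒Sparse (∈-sublists-interval⇒Ascending 2 (n ∸ 2) (subst (λ R → _ ∈ sublists R) (range≡interval 2 (n ∸ 2)) F∈′))
                  (Equivalence.to Boolₚ.T-≡ nc)

∑-Fn : ∀ n {Q} (g : List ℕ → ℚ) → Sparse 2 Q → All (_< n) Q → (∑[ F ∈ Fn n ] (g F * ⟦ eqListℕ Q F ⟧)) ≡ g Q
∑-Fn n {Q} g sparse Q<n = begin
  (∑[ F ∈ Fn n ] (g F * ⟦ eqListℕ Q F ⟧))
    ≡⟨ ∑-filter noConsec (sublists R) _ ⟩
  (∑[ F ∈ sublists R ] (⟦ noConsec F ⟧ * (g F * ⟦ eqListℕ Q F ⟧)))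
    ≡⟨ ∑-cong (sublists R) (λ {F} _ → only-Q F) ⟩
  (∑[ F ∈ sublists R ] (g Q * ⟦ eqListℕ Q F ⟧))
    ≡⟨ ∑-*ˡ (sublists R) (g Q) _ ⟩
  g Q * (∑[ F ∈ sublists R ] ⟦ eqListℕ Q F ⟧)
    ≡⟨ cong (g Q *_) (∑-sublists-eqListℕ Q R) ⟩
  g Q * occurrences Q R
    ≡⟨ cong (λ R → g Q * occurrences Q R) (range≡interval 2 (n ∸ 2)) ⟩
  g Q * occurrences Q (interval 2 (n ∸ 2))
    ≡⟨ cong (g Q *_) (occurrences-interval 2 (n ∸ 2) (Sparse⇒Ascending sparse)
                                          (All.map (λ q<n → ℕₚ.<-≤-trans q<n (ℕₚ.m≤n+m∸n n 2)) Q<n)) ⟩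
  g Q * 1ℚ
    ≡⟨ ℚₚ.*-identityʳ _ ⟩
  g Q ∎
  where
  open ≡-Reasoning
  R = range 2 (n ∸ 2)
  only-Q : ∀ F → ⟦ noConsec F ⟧ * (g F * ⟦ eqListℕ Q F ⟧) ≡ g Q * ⟦ eqListℕ Q F ⟧
  only-Q F with eqListℕ Q F in Q≡F
  ... | true  rewrite sym (eqListℕ-sound Q F Q≡F) | Sparse⇒noConsec sparse = ℚₚ.*-identityˡ _
  ... | false = trans (cong (⟦ noConsec F ⟧ *_) (ℚₚ.*-zeroʳ (g F)))
                      (trans (ℚₚ.*-zeroʳ ⟦ noConsec F ⟧) (sym (ℚₚ.*-zeroʳ (g Q))))

φ-cong : ∀ n {x x′ : QB} σ → (∀ {w} → w ∈ Bn n → x w ≡ x′ w) → φ n x σ ≡ φ n x′ σ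
φ-cong n σ x≗x′ = ∑-cong (filter (λ w → T? (eqListℕ (map ∣_∣ w) σ)) (Bn n))
  (x≗x′ ∘ proj₁ ∘ ∈-filter⁻ (λ w → T? (eqListℕ (map ∣_∣ w) σ)) {xs = Bn n})

φ-∑ : ∀ n (As : List A) (c : A → ℚ) (g : A → QB) {σ} → σ ∈ Sn n →
      φ n (λ w → ∑[ a ∈ As ] (c a * g a w)) σ ≡ (∑[ a ∈ As ] (c a * φ n (g a) σ))
φ-∑ n As c g {σ} σ∈ = begin
  φ n (λ w → ∑[ a ∈ As ] (c a * g a w)) σ
    ≡⟨ φ-signings n _ σ∈ ⟩
  (∑[ w ∈ signings σ ] ∑[ a ∈ As ] (c a * g a w))
    ≡⟨ ∑-comm (signings σ) As (λ w a → c a * g a w) ⟩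
  (∑[ a ∈ As ] ∑[ w ∈ signings σ ] (c a * g a w))
    ≡⟨ ∑-cong As (λ {a} _ → trans (∑-*ˡ (signings σ) (c a) (g a)) (cong (c a *_) (sym (φ-signings n (g a) σ∈)))) ⟩
  (∑[ a ∈ As ] (c a * φ n (g a) σ)) ∎
  where open ≡-Reasoning

φ-span⊆PeakAlg : ∀ {n} gens {y} → 1 ≤ n → (∀ {K} → K ∈ gens → Generator K) →
                 InImageφ n (InSpan (Bn n) gens X) y → PeakAlg n y
φ-span⊆PeakAlg {n} gens {y} 1≤n generator (x , (c , x≡) , y≡) = g , y≡∑P
  where
  g : List ℕ → ℚ
  g Q = ∑[ K ∈ gens ] (c K * (weight K 0 n * ⟦ covers K Q ⟧))
  y≡∑P : ∀ σ → σ ∈ Sn n → y σ ≡ (∑[ F ∈ Fn n ] (g F * P F σ))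
  y≡∑P σ σ∈ = begin
    y σ
      ≡⟨ y≡ σ σ∈ ⟩
    φ n x σ
      ≡⟨ φ-cong n σ (λ {w} w∈ → x≡ w w∈) ⟩
    φ n (λ w → ∑[ K ∈ gens ] (c K * X K w)) σ
      ≡⟨ φ-∑ n gens c X σ∈ ⟩
    (∑[ K ∈ gens ] (c K * φ n (X K) σ))
      ≡⟨ ∑-cong gens (λ {K} K∈ → cong (c K *_) (φ-X {n} 1≤n (generator K∈) σ∈)) ⟩
    g (Peak σ)
      ≡⟨ ∑-Fn n g (Sparse-peakGo 1 σ) (Peak-bounded 1≤n σ∈) ⟨
    (∑[ F ∈ Fn n ] (g F * P F σ)) ∎
    where open ≡-Reasoning

∈gensI0⇒Generator : ∀ {n K} → K ∈ gensI0 n → Generator K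
∈gensI0⇒Generator {n} K∈ with J , J∈ , refl ← ∈-map⁻ (0 ∷_) K∈ =
  0∷ ∈-sublists-interval⇒Ascending 1 (n ∸ 1) (subst (λ R → J ∈ sublists R) (range≡interval 1 (n ∸ 1)) J∈)

∈gensI01⇒Generator : ∀ {n K} → K ∈ gensI01 n → Generator K
∈gensI01⇒Generator {n} {K} K∈
  with K∈′ , 0∈∨1∈ ← ∈-filter⁻ (λ J → T? (memℕ 0 J ∨ memℕ 1 J)) {xs = sublists (range 0 n)} K∈ =
  generator (∈-sublists-interval⇒Ascending 0 n (subst (λ R → K ∈ sublists R) (range≡interval 0 n) K∈′)) 0∈∨1∈
  where
  generator : ∀ {K} → Ascending 0 K → T (memℕ 0 K ∨ memℕ 1 K) → Generator K
  generator {zero ∷ J}        (_ ∷ asc) _ = 0∷ asc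
  generator {suc zero ∷ J}    (_ ∷ asc) _ = 1∷ asc
  generator {suc (suc j) ∷ J} (_ ∷ asc) 0∈∨1∈
    rewrite memℕ-Ascending-suc 0 (Ascending-weaken (s≤s z≤n) asc)
          | memℕ-Ascending-suc 1 (Ascending-weaken (s≤s (s≤s z≤n)) asc) = ⊥-elim 0∈∨1∈

altSign : ℕ → ℚ
altSign zero    = 1ℚ
altSign (suc k) = - altSign k

⟦even⟧ : ℕ → ℚ
⟦even⟧ zero          = 1ℚ
⟦even⟧ (suc zero)    = 0ℚ
⟦even⟧ (suc (suc k)) = ⟦even⟧ k

altSign+⟦even⟧ : ∀ d → altSign d + (- ⟦even⟧ d + ⟦even⟧ (suc d)) ≡ 0ℚ
altSign+⟦even⟧ zero          = refl
altSign+⟦even⟧ (suc zero)    = refl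
altSign+⟦even⟧ (suc (suc d)) rewrite solve 1 (λ x → :- (:- x) := x) refl (altSign d) = altSign+⟦even⟧ d

-- Chosen so that on the gap (a, f) the functions [J covers Q] combine to [Q = {f}] (∑-segmentCoeff).
segmentCoeff : ℕ → ℕ → List ℕ → ℚ
segmentCoeff a f []          = - ⟦even⟧ (f ∸ a)
segmentCoeff a f (j ∷ [])    = altSign (f ∸ suc j)
segmentCoeff a f (_ ∷ _ ∷ _) = 0ℚ

segmentCoeff-suc : ∀ a f J →
  segmentCoeff a f J ≡ segmentCoeff (suc a) f J + ⟦ null J ⟧ * (- ⟦even⟧ (f ∸ a) + ⟦even⟧ (f ∸ suc a))
segmentCoeff-suc a f []          =
  solve 2 (λ x y → :- x := :- y :+ con 1ℚ :* (:- x :+ y)) refl (⟦even⟧ (f ∸ a)) (⟦even⟧ (f ∸ suc a))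
segmentCoeff-suc a f (j ∷ [])    = sym (trans (cong (altSign (f ∸ suc j) +_) (ℚₚ.*-zeroˡ δ)) (ℚₚ.+-identityʳ _))
  where δ = - ⟦even⟧ (f ∸ a) + ⟦even⟧ (f ∸ suc a)
segmentCoeff-suc a f (_ ∷ _ ∷ _) = sym (trans (cong (0ℚ +_) (ℚₚ.*-zeroˡ δ)) (ℚₚ.+-identityʳ 0ℚ))
  where δ = - ⟦even⟧ (f ∸ a) + ⟦even⟧ (f ∸ suc a)

covers-[] : ∀ Q → covers [] Q ≡ null Q
covers-[] []      = refl
covers-[] (q ∷ Q) = refl

eqListℕ-[] : ∀ Q → eqListℕ Q [] ≡ null Q
eqListℕ-[] []      = refl
eqListℕ-[] (q ∷ Q) = refl

eqListℕ-[]-Ascending : ∀ j {Q} → Ascending (suc j) Q → eqListℕ Q (j ∷ []) ≡ false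
eqListℕ-[]-Ascending j []          = refl
eqListℕ-[]-Ascending j (j<q ∷ _) rewrite ≡ᵇ-false (ℕₚ.>⇒≢ j<q) = refl

covered-far : ∀ j {p} → suc j < p → covered (j ∷ []) p ≡ false
covered-far j {suc p} (s≤s j<p) rewrite ≡ᵇ-false (ℕₚ.>⇒≢ j<p) | ≡ᵇ-false (ℕₚ.>⇒≢ (ℕₚ.m<n⇒m<1+n j<p)) = refl

covers-far : ∀ j {Q} → Ascending (2 ℕ.+ j) Q → covers (j ∷ []) Q ≡ null Q
covers-far j []            = refl
covers-far j (j+2≤q ∷ _) rewrite covered-far j j+2≤q = refl

covers-singleton : ∀ a {Q} → Sparse (2 ℕ.+ a) Q → ⟦ covers (suc a ∷ []) Q ⟧ ≡ ⟦ null Q ⟧ + ⟦ eqListℕ Q (2 ℕ.+ a ∷ []) ⟧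
covers-singleton a []                     = refl
covers-singleton a {q ∷ Q} (a+2≤q ∷ sparse) with ℕₚ.m≤n⇒m<n∨m≡n a+2≤q
... | inj₁ a+2<q rewrite covered-far (suc a) a+2<q | ≡ᵇ-false (ℕₚ.>⇒≢ a+2<q) = refl
... | inj₂ refl rewrite ≡ᵇ-refl (suc a)
                      | covers-far (suc a) (Ascending-weaken (ℕₚ.n≤1+n _) (Sparse⇒Ascending sparse)) | eqListℕ-[] Q =
  sym (ℚₚ.+-identityˡ _)

∑-segmentCoeff-suc : ∀ a f L (g : List ℕ → ℚ) →
  (∑[ J ∈ sublists L ] (segmentCoeff a f J * g J))
  ≡ (∑[ J ∈ sublists L ] (segmentCoeff (suc a) f J * g J)) + (- ⟦even⟧ (f ∸ a) + ⟦even⟧ (f ∸ suc a)) * g []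
∑-segmentCoeff-suc a f L g = begin
  (∑[ J ∈ sublists L ] (segmentCoeff a f J * g J))
    ≡⟨ ∑-cong (sublists L) (λ {J} _ → split J) ⟩
  (∑[ J ∈ sublists L ] (segmentCoeff (suc a) f J * g J + ⟦ null J ⟧ * (δ * g J)))
    ≡⟨ ∑-+ (sublists L) _ _ ⟩
  (∑[ J ∈ sublists L ] (segmentCoeff (suc a) f J * g J)) + (∑[ J ∈ sublists L ] (⟦ null J ⟧ * (δ * g J)))
    ≡⟨ cong ((∑[ J ∈ sublists L ] (segmentCoeff (suc a) f J * g J)) +_) (∑-sublists-null L (λ J → δ * g J)) ⟩
  (∑[ J ∈ sublists L ] (segmentCoeff (suc a) f J * g J)) + δ * g [] ∎
  where
  open ≡-Reasoning
  δ = - ⟦even⟧ (f ∸ a) + ⟦even⟧ (f ∸ suc a)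
  split : ∀ J → segmentCoeff a f J * g J ≡ segmentCoeff (suc a) f J * g J + ⟦ null J ⟧ * (δ * g J)
  split J = trans (cong (_* g J) (segmentCoeff-suc a f J))
    (solve 4 (λ s n d x → (s :+ n :* d) :* x := s :* x :+ n :* (d :* x)) refl
           (segmentCoeff (suc a) f J) ⟦ null J ⟧ δ (g J))

∸-by-sum : ∀ a {k f} → a ℕ.+ k ≡ f → f ∸ a ≡ k
∸-by-sum a {k} refl = ℕₚ.m+n∸m≡n a k

segment-decompose : ∀ d a f Q → a ℕ.+ suc (suc d) ≡ f →
  (∑[ J ∈ sublists (interval (suc a) (suc d)) ] (segmentCoeff a f J * ⟦ covers J Q ⟧))
  ≡ altSign d * ⟦ covers (suc a ∷ []) Q ⟧
    + ((∑[ J ∈ sublists (interval (2 ℕ.+ a) d) ] (segmentCoeff (suc a) f J * ⟦ covers J Q ⟧))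
       + (- ⟦even⟧ d + ⟦even⟧ (suc d)) * ⟦ null Q ⟧)
segment-decompose d a f Q a+d+2≡f = begin
  ∑ (sublists (interval (suc a) (suc d))) h
    ≡⟨ ∑-sublists-∷ (suc a) (interval (2 ℕ.+ a) d) h ⟩
  (∑[ J ∈ S ] h (suc a ∷ J)) + ∑ S h
    ≡⟨ cong₂ _+_ (trans (∑-cong S (λ {J} _ → only-[] J)) (∑-sublists-null (interval (2 ℕ.+ a) d) _))
                 (∑-segmentCoeff-suc a f (interval (2 ℕ.+ a) d) (λ J → ⟦ covers J Q ⟧)) ⟩
  altSign d * ⟦ covers (suc a ∷ []) Q ⟧ + ((∑[ J ∈ S ] h′ J) + (- ⟦even⟧ (f ∸ a) + ⟦even⟧ (f ∸ suc a)) * ⟦ covers [] Q ⟧)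
    ≡⟨ cong (λ z → altSign d * ⟦ covers (suc a ∷ []) Q ⟧ + ((∑[ J ∈ S ] h′ J) + z))
            (cong₂ (λ k c → (- ⟦even⟧ k + ⟦even⟧ (f ∸ suc a)) * ⟦ c ⟧) (∸-by-sum a a+d+2≡f) (covers-[] Q)) ⟩
  altSign d * ⟦ covers (suc a ∷ []) Q ⟧ + ((∑[ J ∈ S ] h′ J) + (- ⟦even⟧ d + ⟦even⟧ (f ∸ suc a)) * ⟦ null Q ⟧)
    ≡⟨ cong (λ k → altSign d * ⟦ covers (suc a ∷ []) Q ⟧ + ((∑[ J ∈ S ] h′ J) + (- ⟦even⟧ d + ⟦even⟧ k) * ⟦ null Q ⟧))
            (∸-by-sum (suc a) a+1+d+1≡f) ⟩
  altSign d * ⟦ covers (suc a ∷ []) Q ⟧ + ((∑[ J ∈ S ] h′ J) + (- ⟦even⟧ d + ⟦even⟧ (suc d)) * ⟦ null Q ⟧) ∎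
  where
  open ≡-Reasoning
  S = sublists (interval (2 ℕ.+ a) d)
  h h′ : List ℕ → ℚ
  h  J = segmentCoeff a f J * ⟦ covers J Q ⟧
  h′ J = segmentCoeff (suc a) f J * ⟦ covers J Q ⟧
  a+1+d+1≡f : suc a ℕ.+ suc d ≡ f
  a+1+d+1≡f = trans (sym (ℕₚ.+-suc a (suc d))) a+d+2≡f
  only-[] : ∀ J → h (suc a ∷ J) ≡ ⟦ null J ⟧ * (altSign d * ⟦ covers (suc a ∷ []) Q ⟧)
  only-[] []      = trans (cong (λ k → altSign k * ⟦ covers (suc a ∷ []) Q ⟧)
                                (∸-by-sum (2 ℕ.+ a) (trans (sym (ℕₚ.+-suc (suc a) d)) a+1+d+1≡f)))
                          (sym (ℚₚ.*-identityˡ _))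
  only-[] (j ∷ J) = trans (ℚₚ.*-zeroˡ ⟦ covers (suc a ∷ j ∷ J) Q ⟧) (sym (ℚₚ.*-zeroˡ (altSign d * ⟦ covers (suc a ∷ []) Q ⟧)))

segment-without-a+1 : ∀ d a f {Q} → a ℕ.+ suc (suc d) ≡ f → Sparse (2 ℕ.+ a) Q →
  (∑[ J ∈ sublists (interval (2 ℕ.+ a) d) ] (segmentCoeff (suc a) f J * ⟦ covers J Q ⟧))
    ≡ ⟦ eqListℕ Q (f ∷ []) ⟧ + altSign (suc d) * ⟦ eqListℕ Q (2 ℕ.+ a ∷ []) ⟧ →
  (∑[ J ∈ sublists (interval (suc a) (suc d)) ] (segmentCoeff a f J * ⟦ covers J Q ⟧))
    ≡ ⟦ eqListℕ Q (f ∷ []) ⟧ + altSign (2 ℕ.+ d) * ⟦ eqListℕ Q (suc a ∷ []) ⟧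
segment-without-a+1 d a f {Q} a+d+2≡f sparse IH = begin
  (∑[ J ∈ sublists (interval (suc a) (suc d)) ] (segmentCoeff a f J * ⟦ covers J Q ⟧))
    ≡⟨ segment-decompose d a f Q a+d+2≡f ⟩
  alt * ⟦ covers (suc a ∷ []) Q ⟧
    + ((∑[ J ∈ sublists (interval (2 ℕ.+ a) d) ] (segmentCoeff (suc a) f J * ⟦ covers J Q ⟧)) + δ * empty)
    ≡⟨ cong₂ (λ c s → alt * c + (s + δ * empty)) (covers-singleton a sparse) IH ⟩
  alt * (empty + at₂) + ((atF + (- alt) * at₂) + δ * empty)
    ≡⟨ solve 6 (λ A N E X δ B → A :* (N :+ E) :+ ((X :+ (:- A) :* E) :+ δ :* N) := X :+ B :* con 0ℚ :+ N :* (A :+ δ))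
             refl alt empty at₂ atF δ (altSign (2 ℕ.+ d)) ⟩
  atF + altSign (2 ℕ.+ d) * 0ℚ + empty * (alt + δ)
    ≡⟨ cong₂ (λ e z → atF + altSign (2 ℕ.+ d) * ⟦ e ⟧ + empty * z)
             (sym (eqListℕ-[]-Ascending (suc a) (Sparse⇒Ascending sparse))) (altSign+⟦even⟧ d) ⟩
  atF + altSign (2 ℕ.+ d) * ⟦ eqListℕ Q (suc a ∷ []) ⟧ + empty * 0ℚ
    ≡⟨ trans (cong (atF + altSign (2 ℕ.+ d) * ⟦ eqListℕ Q (suc a ∷ []) ⟧ +_) (ℚₚ.*-zeroʳ empty)) (ℚₚ.+-identityʳ _) ⟩
  atF + altSign (2 ℕ.+ d) * ⟦ eqListℕ Q (suc a ∷ []) ⟧ ∎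
  where
  open ≡-Reasoning
  alt   = altSign d
  empty = ⟦ null Q ⟧
  at₂   = ⟦ eqListℕ Q (2 ℕ.+ a ∷ []) ⟧
  atF   = ⟦ eqListℕ Q (f ∷ []) ⟧
  δ     = - ⟦even⟧ d + ⟦even⟧ (suc d)

segment-with-a+1 : ∀ d a f {Q} → a ℕ.+ suc (suc d) ≡ f → Sparse (3 ℕ.+ a) Q →
  (∑[ J ∈ sublists (interval (suc a) (suc d)) ] (segmentCoeff a f J * ⟦ covers J (suc a ∷ Q) ⟧))
    ≡ ⟦ eqListℕ (suc a ∷ Q) (f ∷ []) ⟧ + altSign (2 ℕ.+ d) * ⟦ eqListℕ (suc a ∷ Q) (suc a ∷ []) ⟧
segment-with-a+1 d a f {Q} a+d+2≡f sparse = trans (segment-decompose d a f (suc a ∷ Q) a+d+2≡f) closing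
  where
  a+1<f : suc a < f
  a+1<f = subst (suc a <_) (trans (sym (ℕₚ.+-suc a (suc d))) a+d+2≡f) (s≤s (ℕₚ.m<m+n a (s≤s z≤n)))
  S = sublists (interval (2 ℕ.+ a) d)
  uncovered : ∀ {J} → Ascending (2 ℕ.+ a) J → segmentCoeff (suc a) f J * ⟦ covers J (suc a ∷ Q) ⟧ ≡ 0ℚ
  uncovered {J} asc rewrite memℕ-Ascending-suc a (Ascending-weaken (ℕₚ.n≤1+n _) asc) | memℕ-Ascending-suc (suc a) asc =
    ℚₚ.*-zeroʳ (segmentCoeff (suc a) f J)
  closing : altSign d * ⟦ covers (suc a ∷ []) (suc a ∷ Q) ⟧
              + ((∑[ J ∈ S ] (segmentCoeff (suc a) f J * ⟦ covers J (suc a ∷ Q) ⟧))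
                 + (- ⟦even⟧ d + ⟦even⟧ (suc d)) * ⟦ null (suc a ∷ Q) ⟧)
            ≡ ⟦ eqListℕ (suc a ∷ Q) (f ∷ []) ⟧ + altSign (2 ℕ.+ d) * ⟦ eqListℕ (suc a ∷ Q) (suc a ∷ []) ⟧
  closing rewrite ≡ᵇ-false (ℕₚ.<⇒≢ (ℕₚ.n<1+n a)) | ≡ᵇ-refl a | ≡ᵇ-false (ℕₚ.<⇒≢ a+1<f)
                | covers-far (suc a) (Sparse⇒Ascending sparse) | eqListℕ-[] Q
                | ∑-zero S (uncovered ∘ ∈-sublists-interval⇒Ascending (2 ℕ.+ a) d) =
    solve 3 (λ A N δ → A :* N :+ (con 0ℚ :+ δ :* con 0ℚ) := con 0ℚ :+ (:- (:- A)) :* N) refl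
      (altSign d) ⟦ null Q ⟧ (- ⟦even⟧ d + ⟦even⟧ (suc d))

∑-segmentCoeff : ∀ d a f {Q} → a ℕ.+ suc d ≡ f → Sparse (suc a) Q →
  (∑[ J ∈ sublists (interval (suc a) d) ] (segmentCoeff a f J * ⟦ covers J Q ⟧))
  ≡ ⟦ eqListℕ Q (f ∷ []) ⟧ + altSign (suc d) * ⟦ eqListℕ Q (suc a ∷ []) ⟧
∑-segmentCoeff zero    a f {Q} refl _ rewrite ℕₚ.m+n∸m≡n a 1 | ℕₚ.+-comm a 1 =
  trans (ℚₚ.+-identityʳ _) (trans (ℚₚ.*-zeroˡ ⟦ covers [] Q ⟧)
    (solve 1 (λ t → con 0ℚ := t :+ con (- 1ℚ) :* t) refl ⟦ eqListℕ Q (suc a ∷ []) ⟧))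
∑-segmentCoeff (suc d) a f {[]} a+d+2≡f [] =
  segment-without-a+1 d a f a+d+2≡f [] (∑-segmentCoeff d (suc a) f (trans (sym (ℕₚ.+-suc a (suc d))) a+d+2≡f) [])
∑-segmentCoeff (suc d) a f {q ∷ Q} a+d+2≡f (a+1≤q ∷ sparse) with ℕₚ.m≤n⇒m<n∨m≡n a+1≤q
... | inj₁ a+1<q = segment-without-a+1 d a f a+d+2≡f (a+1<q ∷ sparse)
                     (∑-segmentCoeff d (suc a) f (trans (sym (ℕₚ.+-suc a (suc d))) a+d+2≡f) (a+1<q ∷ sparse))
... | inj₂ refl  = segment-with-a+1 d a f a+d+2≡f sparse

module _ (f : ℕ) where

  takeWhile-++ : ∀ {J₁ J₂} → All (_< f) J₁ → All (f ≤_) J₂ → takeWhile (ℕₚ._<? f) (J₁ ++ J₂) ≡ J₁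
  takeWhile-++ {[]} {[]}     []           []           = refl
  takeWhile-++ {[]} {x ∷ J₂} []           (f≤x ∷ _)   with x ℕ.<ᵇ f | ℕₚ.<ᵇ-reflects-< x f
  ... | true  | ofʸ x<f = contradiction x<f (ℕₚ.≤⇒≯ f≤x)
  ... | false | _       = refl
  takeWhile-++ {x ∷ J₁}      (x<f ∷ J₁<f) J₂≥f with x ℕ.<ᵇ f | ℕₚ.<ᵇ-reflects-< x f
  ... | true  | _         = cong (x ∷_) (takeWhile-++ J₁<f J₂≥f)
  ... | false | ofⁿ x≮f = contradiction x<f x≮f

  dropWhile-++ : ∀ {J₁ J₂} → All (_< f) J₁ → All (f ≤_) J₂ → dropWhile (ℕₚ._<? f) (J₁ ++ J₂) ≡ J₂
  dropWhile-++ {[]} {[]}     []           []           = refl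
  dropWhile-++ {[]} {x ∷ J₂} []           (f≤x ∷ _)   with x ℕ.<ᵇ f | ℕₚ.<ᵇ-reflects-< x f
  ... | true  | ofʸ x<f = contradiction x<f (ℕₚ.≤⇒≯ f≤x)
  ... | false | _       = refl
  dropWhile-++ {x ∷ J₁}      (x<f ∷ J₁<f) J₂≥f with x ℕ.<ᵇ f | ℕₚ.<ᵇ-reflects-< x f
  ... | true  | _         = dropWhile-++ J₁<f J₂≥f
  ... | false | ofⁿ x≮f = contradiction x<f x≮f

  Ascending-dropWhile : ∀ {i Q} → Ascending i Q → Ascending f (dropWhile (ℕₚ._<? f) Q)
  Ascending-dropWhile []                    = []
  Ascending-dropWhile {Q = q ∷ Q} (_ ∷ asc) with q ℕ.<ᵇ f | ℕₚ.<ᵇ-reflects-< q f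
  ... | true  | _         = Ascending-dropWhile (Ascending-weaken (ℕₚ.n≤1+n _) asc)
  ... | false | ofⁿ q≮f = ℕₚ.≮⇒≥ q≮f ∷ asc

  Sparse-takeWhile : ∀ {i Q} → Sparse i Q → Sparse i (takeWhile (ℕₚ._<? f) Q)
  Sparse-takeWhile []                         = []
  Sparse-takeWhile {Q = q ∷ Q} (i≤q ∷ sparse) with q ℕ.<ᵇ f
  ... | true  = i≤q ∷ Sparse-takeWhile sparse
  ... | false = []

-- A product over the gaps between consecutive elements of a ∷ F; J may not meet F and must be
-- empty beyond its last element.
inverseCoeff : ℕ → List ℕ → List ℕ → ℚ
inverseCoeff a []      J = ⟦ null J ⟧
inverseCoeff a (f ∷ F) J =
  segmentCoeff a f (takeWhile (ℕₚ._<? f) J) * (⟦ not (headIs rest f) ⟧ * inverseCoeff f F rest)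
  where rest = dropWhile (ℕₚ._<? f) J

headIs-Ascending-suc : ∀ f {J} → Ascending (suc f) J → headIs J f ≡ false
headIs-Ascending-suc f []          = refl
headIs-Ascending-suc f (f<j ∷ _) = ≡ᵇ-false (ℕₚ.>⇒≢ f<j)

inverseCoeff-++ : ∀ a f F {J₁ J₃} → All (_< f) J₁ → Ascending (suc f) J₃ →
                  inverseCoeff a (f ∷ F) (J₁ ++ J₃) ≡ segmentCoeff a f J₁ * inverseCoeff f F J₃
inverseCoeff-++ a f F {J₁} {J₃} J₁<f asc
  rewrite takeWhile-++ f J₁<f (All.map ℕₚ.<⇒≤ (Ascending⇒All≤ asc))
        | dropWhile-++ f J₁<f (All.map ℕₚ.<⇒≤ (Ascending⇒All≤ asc)) | headIs-Ascending-suc f asc =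
  cong (segmentCoeff a f J₁ *_) (ℚₚ.*-identityˡ _)

inverseCoeff-++-∷ : ∀ a f F {J₁ J₃} → All (_< f) J₁ → Ascending (suc f) J₃ → inverseCoeff a (f ∷ F) (J₁ ++ f ∷ J₃) ≡ 0ℚ
inverseCoeff-++-∷ a f F {J₁} {J₃} J₁<f asc
  rewrite takeWhile-++ f J₁<f (ℕₚ.≤-refl ∷ All.map ℕₚ.<⇒≤ (Ascending⇒All≤ asc))
        | dropWhile-++ f J₁<f (ℕₚ.≤-refl ∷ All.map ℕₚ.<⇒≤ (Ascending⇒All≤ asc)) | ≡ᵇ-refl f =
  trans (cong (segmentCoeff a f J₁ *_) (ℚₚ.*-zeroˡ (inverseCoeff f F (f ∷ J₃)))) (ℚₚ.*-zeroʳ (segmentCoeff a f J₁))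

covered-++ˡ : ∀ f J₁ {J₃ p} → Ascending (suc f) J₃ → p ≤ f → covered (J₁ ++ J₃) p ≡ covered J₁ p
covered-++ˡ f J₁ {J₃} {p} asc p≤f
  rewrite memℕ-++ (p ∸ 1) J₁ J₃ | memℕ-++ p J₁ J₃
        | memℕ-∉ (p ∸ 1) (All.map (λ f<j → ℕₚ.<⇒≢ (ℕₚ.≤-<-trans (ℕₚ.≤-trans (ℕₚ.m∸n≤m p 1) p≤f) f<j))
                                  (Ascending⇒All≤ asc))
        | memℕ-∉ p (All.map (λ f<j → ℕₚ.<⇒≢ (ℕₚ.≤-<-trans p≤f f<j)) (Ascending⇒All≤ asc))
        | Boolₚ.∨-identityʳ (memℕ (p ∸ 1) J₁) | Boolₚ.∨-identityʳ (memℕ p J₁) = refl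

covered-++ʳ : ∀ f {J₁} J₃ {p} → All (_< f) J₁ → suc f ≤ p → covered (J₁ ++ J₃) p ≡ covered J₃ p
covered-++ʳ f {J₁} J₃ {suc p} J₁<f (s≤s f≤p)
  rewrite memℕ-++ p J₁ J₃ | memℕ-++ (suc p) J₁ J₃
        | memℕ-∉ p (All.map (λ j<f → ℕₚ.>⇒≢ (ℕₚ.<-≤-trans j<f f≤p)) J₁<f)
        | memℕ-∉ (suc p) (All.map (λ j<f → ℕₚ.>⇒≢ (ℕₚ.<-≤-trans j<f (ℕₚ.m≤n⇒m≤1+n f≤p))) J₁<f) = refl

covers-++-split : ∀ f {J₁ J₃ i Q} → All (_< f) J₁ → Ascending (suc f) J₃ → Ascending i Q →
  covers (J₁ ++ J₃) Q ≡ (covers J₁ (takeWhile (ℕₚ._<? suc f) Q) ∧ covers J₃ (dropWhile (ℕₚ._<? suc f) Q))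
covers-++-split f {J₁} {J₃} {Q = Q} J₁<f asc ascQ = begin
  covers (J₁ ++ J₃) Q
    ≡⟨ cong (covers (J₁ ++ J₃)) (Listₚ.takeWhile++dropWhile (ℕₚ._<? suc f) Q) ⟨
  covers (J₁ ++ J₃) (Q₁ ++ Q₂)
    ≡⟨ covers-++ (J₁ ++ J₃) Q₁ Q₂ ⟩
  covers (J₁ ++ J₃) Q₁ ∧ covers (J₁ ++ J₃) Q₂
    ≡⟨ cong₂ _∧_ (covers-cong (Allₚ.all-takeWhile (ℕₚ._<? suc f) Q) (covered-++ˡ f J₁ asc ∘ ℕₚ.≤-pred))
                 (covers-cong (Ascending⇒All≤ (Ascending-dropWhile (suc f) ascQ)) (covered-++ʳ f J₃ J₁<f)) ⟩
  covers J₁ Q₁ ∧ covers J₃ Q₂ ∎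
  where
  open ≡-Reasoning
  Q₁ = takeWhile (ℕₚ._<? suc f) Q
  Q₂ = dropWhile (ℕₚ._<? suc f) Q

eqListℕ-takeWhile-head : ∀ f {i Q F T} → Sparse i Q → Sparse (2 ℕ.+ f) F →
  (Sparse (2 ℕ.+ f) (dropWhile (ℕₚ._<? suc f) Q) → T ≡ ⟦ eqListℕ (dropWhile (ℕₚ._<? suc f) Q) F ⟧) →
  ⟦ eqListℕ (takeWhile (ℕₚ._<? suc f) Q) (f ∷ []) ⟧ * T ≡ ⟦ eqListℕ Q (f ∷ F) ⟧
eqListℕ-takeWhile-head f {Q = Q} {F} {T} sparseQ sparseF rest≡
  with eqListℕ (takeWhile (ℕₚ._<? suc f) Q) (f ∷ []) in Q₁≡[f]
... | true = begin
  1ℚ * T                       ≡⟨ ℚₚ.*-identityˡ T ⟩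
  T                            ≡⟨ rest≡ (tail-Sparse (subst (Sparse _) Q≡ sparseQ)) ⟩
  ⟦ eqListℕ Q₂ F ⟧             ≡⟨ cong (λ b → ⟦ b ∧ eqListℕ Q₂ F ⟧) (≡ᵇ-refl f) ⟨
  ⟦ eqListℕ (f ∷ Q₂) (f ∷ F) ⟧ ≡⟨ cong (λ R → ⟦ eqListℕ R (f ∷ F) ⟧) Q≡ ⟨
  ⟦ eqListℕ Q (f ∷ F) ⟧        ∎
  where
  open ≡-Reasoning
  Q₂ = dropWhile (ℕₚ._<? suc f) Q
  Q≡ : Q ≡ f ∷ Q₂
  Q≡ = trans (sym (Listₚ.takeWhile++dropWhile (ℕₚ._<? suc f) Q)) (cong (_++ Q₂) (eqListℕ-sound _ _ Q₁≡[f]))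
  tail-Sparse : ∀ {i R} → Sparse i (f ∷ R) → Sparse (2 ℕ.+ f) R
  tail-Sparse (_ ∷ sparse) = sparse
... | false = trans (ℚₚ.*-zeroˡ T) (cong ⟦_⟧ (sym (eqListℕ-false Q (f ∷ F) Q≢f∷F)))
  where
  [f]≡[f] : eqListℕ (takeWhile (ℕₚ._<? suc f) (f ∷ F)) (f ∷ []) ≡ true
  [f]≡[f] = trans (cong (λ R → eqListℕ R (f ∷ []))
                        (takeWhile-++ (suc f) {f ∷ []} (ℕₚ.n<1+n f ∷ [])
                                      (All.map (ℕₚ.≤-trans (ℕₚ.n≤1+n _)) (Ascending⇒All≤ (Sparse⇒Ascending sparseF)))))
                  (eqListℕ-refl (f ∷ []))
  Q≢f∷F : Q ≢ f ∷ F
  Q≢f∷F Q≡ = contradiction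
    (trans (sym [f]≡[f]) (trans (cong (λ R → eqListℕ (takeWhile (ℕₚ._<? suc f) R) (f ∷ [])) (sym Q≡)) Q₁≡[f]))
    λ ()

interval-split : ∀ a f m → suc a ≤ f → f ≤ m →
  interval (suc a) (m ∸ a) ≡ interval (suc a) (f ∸ suc a) ++ f ∷ interval (suc f) (m ∸ f)
interval-split a f m a<f f≤m =
  trans (cong (interval (suc a)) (∸-by-sum a a+[d+1+e]≡m))
        (trans (interval-++ (suc a) d (suc e)) (cong (λ g → interval (suc a) d ++ g ∷ interval (suc g) e) a+1+d≡f))
  where
  open ≡-Reasoning
  d = f ∸ suc a
  e = m ∸ f
  a+1+d≡f : suc a ℕ.+ d ≡ f
  a+1+d≡f = ℕₚ.m+[n∸m]≡n a<f
  a+[d+1+e]≡m : a ℕ.+ (d ℕ.+ suc e) ≡ m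
  a+[d+1+e]≡m = begin
    a ℕ.+ (d ℕ.+ suc e) ≡⟨ ℕₚ.+-assoc a d (suc e) ⟨
    a ℕ.+ d ℕ.+ suc e   ≡⟨ ℕₚ.+-suc (a ℕ.+ d) e ⟩
    suc a ℕ.+ d ℕ.+ e   ≡⟨ cong (ℕ._+ e) a+1+d≡f ⟩
    f ℕ.+ e             ≡⟨ ℕₚ.m+[n∸m]≡n f≤m ⟩
    m                   ∎

∑-inverseCoeff-segment : ∀ a f F e {i J₁ Q} → All (_< f) J₁ → Ascending i Q →
  (∑[ J₂ ∈ sublists (f ∷ interval (suc f) e) ]
     (inverseCoeff a (f ∷ F) (J₁ ++ J₂) * ⟦ covers (J₁ ++ J₂) Q ⟧))
  ≡ (segmentCoeff a f J₁ * ⟦ covers J₁ (takeWhile (ℕₚ._<? suc f) Q) ⟧)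
    * (∑[ J₃ ∈ sublists (interval (suc f) e) ]
         (inverseCoeff f F J₃ * ⟦ covers J₃ (dropWhile (ℕₚ._<? suc f) Q) ⟧))
∑-inverseCoeff-segment a f F e {J₁ = J₁} {Q} J₁<f ascQ = begin
  (∑[ J₂ ∈ sublists (f ∷ R) ] h (J₁ ++ J₂))
    ≡⟨ ∑-sublists-∷ f R (λ J₂ → h (J₁ ++ J₂)) ⟩
  (∑[ J₃ ∈ sublists R ] h (J₁ ++ f ∷ J₃)) + (∑[ J₃ ∈ sublists R ] h (J₁ ++ J₃))
    ≡⟨ cong₂ _+_ (∑-zero (sublists R) (λ {J₃} J₃∈ → trans (cong (_* ⟦ covers (J₁ ++ f ∷ J₃) Q ⟧)
                                                                  (inverseCoeff-++-∷ a f F J₁<f (ascending J₃∈)))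
                                                            (ℚₚ.*-zeroˡ ⟦ covers (J₁ ++ f ∷ J₃) Q ⟧)))
                 (∑-cong (sublists R) factor) ⟩
  0ℚ + (∑[ J₃ ∈ sublists R ] (c * (inverseCoeff f F J₃ * ⟦ covers J₃ Q₂ ⟧)))
    ≡⟨ ℚₚ.+-identityˡ _ ⟩
  (∑[ J₃ ∈ sublists R ] (c * (inverseCoeff f F J₃ * ⟦ covers J₃ Q₂ ⟧)))
    ≡⟨ ∑-*ˡ (sublists R) c _ ⟩
  c * (∑[ J₃ ∈ sublists R ] (inverseCoeff f F J₃ * ⟦ covers J₃ Q₂ ⟧)) ∎
  where
  open ≡-Reasoning
  R  = interval (suc f) e
  Q₁ = takeWhile (ℕₚ._<? suc f) Q
  Q₂ = dropWhile (ℕₚ._<? suc f) Q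
  h : List ℕ → ℚ
  h J = inverseCoeff a (f ∷ F) J * ⟦ covers J Q ⟧
  c = segmentCoeff a f J₁ * ⟦ covers J₁ Q₁ ⟧
  ascending : ∀ {J₃} → J₃ ∈ sublists R → Ascending (suc f) J₃
  ascending = ∈-sublists-interval⇒Ascending (suc f) e
  factor : ∀ {J₃} → J₃ ∈ sublists R → h (J₁ ++ J₃) ≡ c * (inverseCoeff f F J₃ * ⟦ covers J₃ Q₂ ⟧)
  factor {J₃} J₃∈ = trans
    (cong₂ _*_ (inverseCoeff-++ a f F J₁<f (ascending J₃∈))
               (trans (cong ⟦_⟧ (covers-++-split f J₁<f (ascending J₃∈) ascQ)) (⟦∧⟧ (covers J₁ Q₁) (covers J₃ Q₂))))
    (solve 4 (λ s i x y → (s :* i) :* (x :* y) := (s :* x) :* (i :* y)) refl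
           (segmentCoeff a f J₁) (inverseCoeff f F J₃) ⟦ covers J₁ Q₁ ⟧ ⟦ covers J₃ Q₂ ⟧)

∑-inverseCoeff : ∀ m F a {Q} → Sparse (2 ℕ.+ a) F → All (_< suc m) F → Sparse (2 ℕ.+ a) Q → All (_< suc m) Q →
  (∑[ J ∈ sublists (interval (suc a) (m ∸ a)) ] (inverseCoeff a F J * ⟦ covers J Q ⟧)) ≡ ⟦ eqListℕ Q F ⟧
∑-inverseCoeff m []      a {Q} _ _ _ _ = trans (∑-sublists-null (interval (suc a) (m ∸ a)) (λ J → ⟦ covers J Q ⟧))
                                               (cong ⟦_⟧ (trans (covers-[] Q) (sym (eqListℕ-[] Q))))
∑-inverseCoeff m (f ∷ F) a {Q} (a+2≤f ∷ sparseF) (f<m+1 ∷ F<m+1) sparseQ Q<m+1 = begin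
  ∑ (sublists (interval (suc a) (m ∸ a))) h
    ≡⟨ cong (λ R → ∑ (sublists R) h) (interval-split a f m a<f (ℕₚ.≤-pred f<m+1)) ⟩
  ∑ (sublists (R₁ ++ f ∷ R₂)) h
    ≡⟨ ∑-sublists-++ R₁ (f ∷ R₂) h ⟩
  (∑[ J₁ ∈ sublists R₁ ] ∑[ J₂ ∈ sublists (f ∷ R₂) ] h (J₁ ++ J₂))
    ≡⟨ ∑-cong (sublists R₁) (λ J₁∈ → ∑-inverseCoeff-segment a f F (m ∸ f) (J₁<f J₁∈) (Sparse⇒Ascending sparseQ)) ⟩
  (∑[ J₁ ∈ sublists R₁ ] ((segmentCoeff a f J₁ * ⟦ covers J₁ Q₁ ⟧) * rest))
    ≡⟨ ∑-*ʳ (sublists R₁) rest _ ⟩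
  (∑[ J₁ ∈ sublists R₁ ] (segmentCoeff a f J₁ * ⟦ covers J₁ Q₁ ⟧)) * rest
    ≡⟨ cong (_* rest) (∑-segmentCoeff d a f a+d+1≡f (Sparse-takeWhile (suc f) (Sparse-weaken (ℕₚ.n≤1+n _) sparseQ))) ⟩
  (⟦ eqListℕ Q₁ (f ∷ []) ⟧ + altSign (suc d) * ⟦ eqListℕ Q₁ (suc a ∷ []) ⟧) * rest
    ≡⟨ cong (λ b → (⟦ eqListℕ Q₁ (f ∷ []) ⟧ + altSign (suc d) * ⟦ b ⟧) * rest)
            (eqListℕ-[]-Ascending (suc a) (Sparse⇒Ascending (Sparse-takeWhile (suc f) sparseQ))) ⟩
  (⟦ eqListℕ Q₁ (f ∷ []) ⟧ + altSign (suc d) * 0ℚ) * rest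
    ≡⟨ cong (_* rest) (trans (cong (⟦ eqListℕ Q₁ (f ∷ []) ⟧ +_) (ℚₚ.*-zeroʳ (altSign (suc d))))
                             (ℚₚ.+-identityʳ ⟦ eqListℕ Q₁ (f ∷ []) ⟧)) ⟩
  ⟦ eqListℕ Q₁ (f ∷ []) ⟧ * rest
    ≡⟨ eqListℕ-takeWhile-head f sparseQ sparseF (λ sparseQ₂ →
         ∑-inverseCoeff m F f sparseF F<m+1 sparseQ₂ (Allₚ.dropWhile⁺ (ℕₚ._<? suc f) Q<m+1)) ⟩
  ⟦ eqListℕ Q (f ∷ F) ⟧ ∎
  where
  open ≡-Reasoning
  d  = f ∸ suc a
  R₁ = interval (suc a) d
  R₂ = interval (suc f) (m ∸ f)
  Q₁ = takeWhile (ℕₚ._<? suc f) Q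
  h : List ℕ → ℚ
  h J = inverseCoeff a (f ∷ F) J * ⟦ covers J Q ⟧
  rest = ∑[ J₃ ∈ sublists R₂ ] (inverseCoeff f F J₃ * ⟦ covers J₃ (dropWhile (ℕₚ._<? suc f) Q) ⟧)
  a<f : suc a ≤ f
  a<f = ℕₚ.≤-trans (ℕₚ.n≤1+n _) a+2≤f
  a+d+1≡f : a ℕ.+ suc d ≡ f
  a+d+1≡f = trans (ℕₚ.+-suc a d) (ℕₚ.m+[n∸m]≡n a<f)
  J₁<f : ∀ {J₁} → J₁ ∈ sublists R₁ → All (_< f) J₁
  J₁<f {J₁} J₁∈ = subst (λ b → All (_< b) J₁) (ℕₚ.m+[n∸m]≡n a<f) (∈-sublists-interval⇒bounded (suc a) d J₁∈)

weight⁻¹ : List ℕ → ℕ → ℕ → ℚ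
weight⁻¹ J i zero    = 1ℚ
weight⁻¹ J i (suc L) = if headIs J i then ½ * weight⁻¹ (drop 1 J) (suc i) L else weight⁻¹ J (suc i) L

weight⁻¹*weight : ∀ J i L → weight⁻¹ J i L * weight J i L ≡ 1ℚ
weight⁻¹*weight J i zero    = refl
weight⁻¹*weight J i (suc L) with headIs J i
... | true  = trans (solve 2 (λ u w → (con ½ :* u) :* (con 2ℚ :* w) := (con ½ :* con 2ℚ) :* (u :* w)) refl
                             (weight⁻¹ (drop 1 J) (suc i) L) (weight (drop 1 J) (suc i) L))
                    (cong ((½ * 2ℚ) *_) (weight⁻¹*weight (drop 1 J) (suc i) L))
... | false = weight⁻¹*weight J (suc i) L

∈Fn⇒bounded : ∀ {n F} → 1 ≤ n → F ∈ Fn n → All (_< n) F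
∈Fn⇒bounded {suc m} {F} _ F∈
  with F∈′ , _ ← ∈-filter⁻ (λ F → T? (noConsec F)) {xs = sublists (range 2 (suc m ∸ 2))} F∈ =
  bounded m (subst (λ R → F ∈ sublists R) (range≡interval 2 (suc m ∸ 2)) F∈′)
  where
  bounded : ∀ m → F ∈ sublists (interval 2 (suc m ∸ 2)) → All (_< suc m) F
  bounded zero     (here refl) = []
  bounded (suc m′) F∈″         = ∈-sublists-interval⇒bounded 2 m′ F∈″

module _ (m : ℕ) (coeff : List ℕ → ℚ) where

  normalised : List ℕ → ℚ
  normalised []          = 0ℚ
  normalised (zero ∷ J)  = coeff J * weight⁻¹ (0 ∷ J) 0 (suc m)
  normalised (suc _ ∷ _) = 0ℚ

  φ-normalised : ∀ {σ} → σ ∈ Sn (suc m) →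
    φ (suc m) (λ w → ∑[ K ∈ gensI0 (suc m) ] (normalised K * X K w)) σ
    ≡ (∑[ J ∈ sublists (range 1 m) ] (coeff J * ⟦ covers J (Peak σ) ⟧))
  φ-normalised {σ} σ∈ = begin
    φ (suc m) (λ w → ∑[ K ∈ gensI0 (suc m) ] (normalised K * X K w)) σ
      ≡⟨ φ-∑ (suc m) (gensI0 (suc m)) normalised X σ∈ ⟩
    (∑[ K ∈ gensI0 (suc m) ] (normalised K * φ (suc m) (X K) σ))
      ≡⟨ ∑-cong (gensI0 (suc m)) (λ {K} K∈ →
           cong (normalised K *_) (φ-X {suc m} (s≤s z≤n) (∈gensI0⇒Generator {suc m} K∈) σ∈)) ⟩
    (∑[ K ∈ gensI0 (suc m) ] (normalised K * (weight K 0 (suc m) * ⟦ covers K (Peak σ) ⟧)))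
      ≡⟨ ∑-map (0 ∷_) (sublists (range 1 m)) _ ⟩
    (∑[ J ∈ sublists (range 1 m) ] ((coeff J * w⁻¹ J) * (w J * ⟦ covers (0 ∷ J) (Peak σ) ⟧)))
      ≡⟨ ∑-cong (sublists (range 1 m)) (λ {J} _ → cancel J) ⟩
    (∑[ J ∈ sublists (range 1 m) ] (coeff J * ⟦ covers J (Peak σ) ⟧)) ∎
    where
    open ≡-Reasoning
    w w⁻¹ : List ℕ → ℚ
    w   J = weight (0 ∷ J) 0 (suc m)
    w⁻¹ J = weight⁻¹ (0 ∷ J) 0 (suc m)
    cancel : ∀ J → (coeff J * w⁻¹ J) * (w J * ⟦ covers (0 ∷ J) (Peak σ) ⟧) ≡ coeff J * ⟦ covers J (Peak σ) ⟧
    cancel J = begin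
      (coeff J * w⁻¹ J) * (w J * ⟦ covers (0 ∷ J) (Peak σ) ⟧)
        ≡⟨ solve 4 (λ c u w k → (c :* u) :* (w :* k) := (u :* w) :* (c :* k)) refl (coeff J) (w⁻¹ J) (w J) _ ⟩
      (w⁻¹ J * w J) * (coeff J * ⟦ covers (0 ∷ J) (Peak σ) ⟧)
        ≡⟨ cong₂ (λ u k → u * (coeff J * ⟦ k ⟧)) (weight⁻¹*weight (0 ∷ J) 0 (suc m)) (covers-0∷ J (Sparse-peakGo 1 σ)) ⟩
      1ℚ * (coeff J * ⟦ covers J (Peak σ) ⟧)
        ≡⟨ ℚₚ.*-identityˡ _ ⟩
      coeff J * ⟦ covers J (Peak σ) ⟧ ∎

PeakAlg⊆φ-I0 : ∀ m {y} → PeakAlg (suc m) y → InImageφ (suc m) (I0 (suc m)) y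
PeakAlg⊆φ-I0 m {y} (d , y≡) =
  _ , (normalised m coeff , λ _ _ → refl) ,
  λ σ σ∈ → trans (y≡ σ σ∈) (sym (trans (φ-normalised m coeff σ∈) (inverted σ∈)))
  where
  n = suc m
  S = sublists (range 1 m)
  coeff : List ℕ → ℚ
  coeff J = ∑[ F ∈ Fn n ] (d F * inverseCoeff 0 F J)
  inverted : ∀ {σ} → σ ∈ Sn n → (∑[ J ∈ S ] (coeff J * ⟦ covers J (Peak σ) ⟧)) ≡ (∑[ F ∈ Fn n ] (d F * P F σ))
  inverted {σ} σ∈ = begin
    (∑[ J ∈ S ] (coeff J * ⟦ covers J (Peak σ) ⟧))
      ≡⟨ ∑-cong S (λ {J} _ → trans (sym (∑-*ʳ (Fn n) ⟦ covers J (Peak σ) ⟧ _))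
                                   (∑-cong (Fn n) λ {F} _ → ℚₚ.*-assoc (d F) (inverseCoeff 0 F J) _)) ⟩
    (∑[ J ∈ S ] ∑[ F ∈ Fn n ] (d F * (inverseCoeff 0 F J * ⟦ covers J (Peak σ) ⟧)))
      ≡⟨ ∑-comm S (Fn n) _ ⟩
    (∑[ F ∈ Fn n ] ∑[ J ∈ S ] (d F * (inverseCoeff 0 F J * ⟦ covers J (Peak σ) ⟧)))
      ≡⟨ ∑-cong (Fn n) (λ {F} F∈ → trans (∑-*ˡ S (d F) _) (cong (d F *_) (invert F∈))) ⟩
    (∑[ F ∈ Fn n ] (d F * P F σ)) ∎
    where
    open ≡-Reasoning
    invert : ∀ {F} → F ∈ Fn n → (∑[ J ∈ S ] (inverseCoeff 0 F J * ⟦ covers J (Peak σ) ⟧)) ≡ P F σ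
    invert {F} F∈ =
      trans (cong (λ R → ∑[ J ∈ sublists R ] (inverseCoeff 0 F J * ⟦ covers J (Peak σ) ⟧)) (range≡interval 1 m))
            (∑-inverseCoeff m F 0 (∈Fn⇒Sparse {n} F∈) (∈Fn⇒bounded (s≤s z≤n) F∈)
                                  (Sparse-peakGo 1 σ) (Peak-bounded (s≤s z≤n) σ∈))

I0⊆I01 : ∀ m {x} → I0 (suc m) x → I01 (suc m) x
I0⊆I01 m {x} (c , x≡) = c′ , λ k k∈ → trans (x≡ k k∈) (∑-I0≡∑-I01 k)
  where
  c′ : List ℕ → ℚ
  c′ []          = 0ℚ
  c′ (zero ∷ J)  = c (0 ∷ J)
  c′ (suc _ ∷ _) = 0ℚ
  p : List ℕ → Bool
  p J = memℕ 0 J ∨ memℕ 1 J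
  ∑-I0≡∑-I01 : ∀ k → (∑[ K ∈ gensI0 (suc m) ] (c K * X K k)) ≡ (∑[ K ∈ gensI01 (suc m) ] (c′ K * X K k))
  ∑-I0≡∑-I01 k = begin
    (∑[ K ∈ gensI0 (suc m) ] (c K * X K k))
      ≡⟨ ∑-map (0 ∷_) (sublists (range 1 m)) _ ⟩
    (∑[ J ∈ sublists (range 1 m) ] (c (0 ∷ J) * X (0 ∷ J) k))
      ≡⟨ cong (λ R → ∑[ J ∈ sublists R ] (c (0 ∷ J) * X (0 ∷ J) k)) (range≡interval 1 m) ⟩
    (∑[ J ∈ sublists (interval 1 m) ] (c (0 ∷ J) * X (0 ∷ J) k))
      ≡⟨ ∑-cong (sublists (interval 1 m)) (λ _ → ℚₚ.*-identityˡ _) ⟨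
    (∑[ J ∈ sublists (interval 1 m) ] (⟦ p (0 ∷ J) ⟧ * (c′ (0 ∷ J) * X (0 ∷ J) k)))
      ≡⟨ ℚₚ.+-identityʳ _ ⟨
    (∑[ J ∈ sublists (interval 1 m) ] (⟦ p (0 ∷ J) ⟧ * (c′ (0 ∷ J) * X (0 ∷ J) k))) + 0ℚ
      ≡⟨ cong ((∑[ J ∈ sublists (interval 1 m) ] (⟦ p (0 ∷ J) ⟧ * (c′ (0 ∷ J) * X (0 ∷ J) k))) +_)
              (∑-zero (sublists (interval 1 m)) (not-generator ∘ ∈-sublists-interval⇒Ascending 1 m)) ⟨
    (∑[ J ∈ sublists (interval 1 m) ] (⟦ p (0 ∷ J) ⟧ * (c′ (0 ∷ J) * X (0 ∷ J) k)))
      + (∑[ J ∈ sublists (interval 1 m) ] (⟦ p J ⟧ * (c′ J * X J k)))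
      ≡⟨ ∑-sublists-∷ 0 (interval 1 m) (λ K → ⟦ p K ⟧ * (c′ K * X K k)) ⟨
    ∑ (sublists (interval 0 (suc m))) (λ K → ⟦ p K ⟧ * (c′ K * X K k))
      ≡⟨ cong (λ R → ∑[ K ∈ sublists R ] (⟦ p K ⟧ * (c′ K * X K k))) (range≡interval 0 (suc m)) ⟨
    (∑[ K ∈ sublists (range 0 (suc m)) ] (⟦ p K ⟧ * (c′ K * X K k)))
      ≡⟨ ∑-filter p (sublists (range 0 (suc m))) _ ⟨
    (∑[ K ∈ gensI01 (suc m) ] (c′ K * X K k)) ∎
    where
    open ≡-Reasoning
    c′≡0 : ∀ {J} → Ascending 1 J → c′ J ≡ 0ℚ
    c′≡0 []          = refl
    c′≡0 (s≤s _ ∷ _) = refl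
    not-generator : ∀ {J} → Ascending 1 J → ⟦ p J ⟧ * (c′ J * X J k) ≡ 0ℚ
    not-generator {J} asc =
      trans (cong (⟦ p J ⟧ *_) (trans (cong (_* X J k) (c′≡0 asc)) (ℚₚ.*-zeroˡ (X J k)))) (ℚₚ.*-zeroʳ ⟦ p J ⟧)

φ-I0⊆φ-I01 : ∀ m {y} → InImageφ (suc m) (I0 (suc m)) y → InImageφ (suc m) (I01 (suc m)) y
φ-I0⊆φ-I01 m (x , x∈I0 , y≡) = x , I0⊆I01 m x∈I0 , y≡

theorem5p9 : (n : ℕ) → 1 ≤ n →
    ((y : QS) → InImageφ n (I01 n) y ⇔ InImageφ n (I0 n) y)
    × ((y : QS) → InImageφ n (I0 n) y ⇔ PeakAlg n y)
theorem5p9 (suc m) 1≤n =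
  (λ y → mk⇔ (PeakAlg⊆φ-I0 m ∘ φ-span⊆PeakAlg (gensI01 n) 1≤n (∈gensI01⇒Generator {n})) (φ-I0⊆φ-I01 m)) ,
  (λ y → mk⇔ (φ-span⊆PeakAlg (gensI0 n) 1≤n (∈gensI0⇒Generator {n})) (PeakAlg⊆φ-I0 m))
  where n = suc m
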